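{- Let $H$ be a $4$-divisible graph, let $S$ be a star with an even number of edges, and let $G$ be a graph that has a decomposition $(H, S)$. Then there is a decomposition $(H_1, \ldots, H_4, S_1, \ldots, S_4)$ of $G$ such that: $H_i$ and $S_i$ are vertex-disjoint for each $i \in [4]$; each of $H_1, \ldots, H_4$ is isomorphic to $H/4$; and $S_1, \ldots, S_4$ are stars with $e(S_1) = e(S)/2$.
   Context: A decomposition of a graph $G$ into $(G_1,\dots,G_r)$ means that $G_1,\dots,G_r$ are pairwise edge-disjoint subgraphs of $G$ whose edge sets together cover $E(G)$. A graph $G$ is $r$-divisible if for every graph $F$, the number of connected components of $G$ isomorphic to $F$ is divisible by $r$; in that case $G/r$ denotes (the isomorphism class of) the graph consisting of exactly a $1/r$ fraction of the components of $G$ of each isomorphism type. A star is a graph $K_{1,s}$ with $s \ge 0$ edges (stars with no edges are allowed); $e(\cdot)$ is the number of edges. -}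

module Defs where

open import Data.Nat using (ℕ; zero; suc; _+_; _<ᵇ_; _/_)
open import Data.Nat.Divisibility using (_∣_)
open import Data.Nat.ListAction using (sum)
open import Data.Bool using (Bool; true; false; _∧_; if_then_else_)
open import Data.Bool.Properties using (∧-comm; ∧-assoc)
open import Data.Fin using (Fin; toℕ) renaming (zero to fzero; suc to fsuc)
open import Data.List using (List; []; _∷_; length; map; lookup; allFin)
open import Data.Product using (Σ; ∃; ∃-syntax; _×_; _,_)
open import Relation.Binary.PropositionalEquality using (_≡_; _≢_; refl; sym; trans; cong)
open import Relation.Binary.Construct.Closure.ReflexiveTransitive using (Star)

-- A finite simple graph whose vertex set is a subset V of Fin n
-- (labelled graphs; every finite graph is isomorphic to one of these).
record Graph (n : ℕ) : Set where
  field
    V     : Fin n → Bool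
    E     : Fin n → Fin n → Bool
    E-sym : ∀ u v → E u v ≡ E v u
    E-irr : ∀ u → E u u ≡ false
    E-V   : ∀ u v → E u v ≡ true → V u ≡ true
open Graph public

record _≅_ {n m : ℕ} (G : Graph n) (H : Graph m) : Set where
  field
    f     : Fin n → Fin m
    g     : Fin m → Fin n
    f-V   : ∀ u → V G u ≡ true → V H (f u) ≡ true
    g-V   : ∀ w → V H w ≡ true → V G (g w) ≡ true
    gf    : ∀ u → V G u ≡ true → g (f u) ≡ u
    fg    : ∀ w → V H w ≡ true → f (g w) ≡ w
    f-E   : ∀ u v → V G u ≡ true → V G v ≡ true → E G u v ≡ E H (f u) (f v)

_⊆G_ : ∀ {n} → Graph n → Graph n → Set
A ⊆G B = (∀ u → V A u ≡ true → V B u ≡ true)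
       × (∀ u v → E A u v ≡ true → E B u v ≡ true)

VertexDisjoint : ∀ {n} → Graph n → Graph n → Set
VertexDisjoint A B = ∀ u → V A u ≡ true → V B u ≡ false

e : ∀ {n} → Graph n → ℕ
e {n} G = sum (map (λ i → sum (map (λ j → if (toℕ i <ᵇ toℕ j) ∧ E G i j then 1 else 0)
                                    (allFin n)))
                   (allFin n))

Decomposition : ∀ {n} → Graph n → List (Graph n) → Set
Decomposition {n} G Gs =
    (∀ i → lookup Gs i ⊆G G)
  × (∀ i j → i ≢ j → ∀ u v → E (lookup Gs i) u v ≡ true → E (lookup Gs j) u v ≡ false)
  × (∀ u v → E G u v ≡ true → ∃[ i ] E (lookup Gs i) u v ≡ true)

Adj : ∀ {n} → Graph n → Fin n → Fin n → Set
Adj G u v = E G u v ≡ true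

Reach : ∀ {n} → Graph n → Fin n → Fin n → Set
Reach G = Star (Adj G)

IsComponent : ∀ {n} → Graph n → (Fin n → Bool) → Set
IsComponent {n} G C =
    (∃[ x ] C x ≡ true)
  × (∀ u → C u ≡ true → V G u ≡ true)
  × (∀ u v → C u ≡ true → C v ≡ true → Reach G u v)
  × (∀ u v → C u ≡ true → E G u v ≡ true → C v ≡ true)

induced : ∀ {n} (G : Graph n) (C : Fin n → Bool) → (∀ u → C u ≡ true → V G u ≡ true) → Graph n
induced G C C⊆V = record
  { V = C
  ; E = λ u v → (C u ∧ C v) ∧ E G u v
  ; E-sym = λ u v → trans (cong (_∧ E G u v) (∧-comm (C u) (C v)))
                          (cong ((C v ∧ C u) ∧_) (E-sym G u v))
  ; E-irr = λ u → trans (cong ((C u ∧ C u) ∧_) (E-irr G u)) (∧-comm (C u ∧ C u) false)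
  ; E-V = λ u v p → lem (C u) (C v) (E G u v) p
  }
  where
  lem : ∀ a b c → (a ∧ b) ∧ c ≡ true → a ≡ true
  lem true b c p = refl
  lem false b c ()

compGraph : ∀ {n} (G : Graph n) (C : Fin n → Bool) → IsComponent G C → Graph n
compGraph G C (_ , C⊆V , _) = induced G C C⊆V

CompCount : ∀ {n m} → Graph n → Graph m → ℕ → Set
CompCount {n} G F k =
  Σ (List (Σ (Fin n → Bool) (IsComponent G))) λ Cs →
      length Cs ≡ k
    × (∀ i → let (C , c) = lookup Cs i in compGraph G C c ≅ F)
    × (∀ i j → i ≢ j → let (C , _) = lookup Cs i ; (D , _) = lookup Cs j in
                        ∃[ x ] C x ≢ D x)
    × (∀ C (c : IsComponent G C) → compGraph G C c ≅ F →
         ∃[ i ] (let (D , _) = lookup Cs i in ∀ x → C x ≡ D x))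

Divisible : ∀ {n} → ℕ → Graph n → Set
Divisible {n} r G = ∀ {m} (F : Graph m) (k : ℕ) → CompCount G F k → r ∣ k

-- X is isomorphic to G/4: for every graph F, X has exactly (1/4 of the
-- number of components of G isomorphic to F) components isomorphic to F.
IsQuarterOf : ∀ {n} → Graph n → Graph n → Set
IsQuarterOf {n} X G = ∀ {m} (F : Graph m) (k : ℕ) → CompCount G F k → CompCount X F (k / 4)

-- The star K_{1,s} on vertex set Fin (suc s), centre fzero.
isZero : ∀ {n} → Fin (suc n) → Bool
isZero fzero = true
isZero (fsuc _) = false

xor : Bool → Bool → Bool
xor true b = if b then false else true
xor false b = b

K1 : (s : ℕ) → Graph (suc s)
K1 s = record
  { V = λ _ → true
  ; E = λ u v → xor (isZero u) (isZero v)
  ; E-sym = λ u v → xs (isZero u) (isZero v)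
  ; E-irr = λ u → xx (isZero u)
  ; E-V = λ _ _ _ → refl
  }
  where
  xs : ∀ a b → xor a b ≡ xor b a
  xs true true = refl
  xs true false = refl
  xs false true = refl
  xs false false = refl
  xx : ∀ a → xor a a ≡ false
  xx true = refl
  xx false = refl

IsStar : ∀ {n} → Graph n → Set
IsStar S = ∃[ s ] (S ≅ K1 s)

-- Number the components of each isomorphism type of H as 0, 1, 2, … and put the i-th one into
-- part i + shift (mod 4) of H. Every type occurs 4q times, so each part receives exactly q of them:
-- each part is isomorphic to H/4.
-- Let S = K_{1,2m} have centre c. The shift is chosen so that c lies in part c₀ ∈ {2, 3} and at most
-- m leaves lie in part 0; two consecutive shifts put disjoint vertex sets into part 0, so one of
-- them works. Star 0 takes m leaves outside part 0; every other leaf goes to star 1, or, if it lies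
-- in part 1, to star o, where {c₀, o} = {2, 3}. These three stars are centred at c; star c₀ is a
-- single vertex outside part c₀, which exists because part c₀ cannot hold all components of c's type.

module Submission where

open import Defs
open import Data.Bool using (Bool; true; false; _∧_; _∨_; not; if_then_else_)
open import Data.Bool.Properties using (∧-identityʳ; ∧-zeroʳ; ∨-comm) renaming (_≟_ to _≟ᵇ_)
open import Data.Empty using (⊥-elim)
open import Data.Fin using (Fin; zero; suc; toℕ; fromℕ<; splitAt; join)
open import Data.Fin.Properties
  using (_≟_; suc-injective; all?; any?; toℕ-fromℕ<; toℕ<n; toℕ-injective; splitAt-join; join-splitAt)
  renaming (0≢1+n to 0≢suc)
open import Data.List using (List; []; _∷_; length; lookup; tabulate; map; allFin)
open import Data.List.Properties using (map-tabulate; length-tabulate)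
open import Data.Nat using (ℕ; zero; suc; _+_; _*_; _∸_; _/_; _≤_; _<_; z≤n; s≤s; _<ᵇ_; _≤?_) renaming (_≟_ to _≟ℕ_)
open import Data.Nat.Divisibility using (_∣_; divides)
open import Data.Nat.DivMod using (m*n/n≡m)
open import Data.Nat.ListAction using (sum)
open import Data.Nat.Properties
  using ( *-comm; +-assoc; +-cancelʳ-≤; +-cancelˡ-≤; +-commutativeSemigroup; +-identityʳ; +-mono-≤; +-mono-≤-<
        ; +-monoʳ-<; +-monoʳ-≤; +-monoˡ-≤; +-suc; 1+n≰n; <-cmp; <-irrefl; <-irrelevant; <⇒≤; <⇒≱; m+[n∸m]≡n
        ; m<m*n; m≤m+n; m≤n+m; m≤n⇒m≤1+n; ≤-antisym; ≤-pred; ≤-refl; ≤-reflexive; ≤-trans; ≰⇒>; module ≤-Reasoning )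
open import Data.Nat.Solver using (module +-*-Solver)
open import Algebra.Properties.CommutativeSemigroup +-commutativeSemigroup using (interchange)
open import Data.Product using (Σ; ∃; ∃-syntax; _×_; _,_; proj₁; proj₂)
open import Data.Sum using (_⊎_; inj₁; inj₂; [_,_]′)
open import Function using (_∘_; id)
open import Relation.Binary.Construct.Closure.ReflexiveTransitive using (ε; _◅_; _◅◅_; reverse)
open import Relation.Binary.Definitions using (tri<; tri≈; tri>)
open import Relation.Binary.PropositionalEquality
open import Relation.Nullary using (Dec; yes; no; does)
open import Relation.Nullary.Decidable using (from-yes; dec-true; _×-dec_; _→-dec_)

private variable
  n m k l : ℕ
  a b : Bool
  P Q : Fin n → Bool


≡true⇒≢false : a ≡ true → a ≢ false
≡true⇒≢false refl ()

≢true⇒≡false : a ≢ true → a ≡ false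
≢true⇒≡false {true} a≢true = ⊥-elim (a≢true refl)
≢true⇒≡false {false} _ = refl

not≡true⇒≡false : not a ≡ true → a ≡ false
not≡true⇒≡false {false} _ = refl

⇔⇒≡ : (a ≡ true → b ≡ true) → (b ≡ true → a ≡ true) → a ≡ b
⇔⇒≡ {true} a⇒b _ = sym (a⇒b refl)
⇔⇒≡ {false} {true} _ b⇒a = b⇒a refl
⇔⇒≡ {false} {false} _ _ = refl

∧-projˡ : a ∧ b ≡ true → a ≡ true
∧-projˡ {true} _ = refl

∧-projʳ : a ∧ b ≡ true → b ≡ true
∧-projʳ {a = true} b≡true = b≡true

∧-intro : a ≡ true → b ≡ true → a ∧ b ≡ true
∧-intro refl refl = refl

∨-injˡ : a ≡ true → a ∨ b ≡ true
∨-injˡ {true} _ = refl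

∨-injʳ : b ≡ true → a ∨ b ≡ true
∨-injʳ {a = true} _ = refl
∨-injʳ {a = false} b≡true = b≡true

∨-elim : a ∨ b ≡ true → a ≡ true ⊎ b ≡ true
∨-elim {true} _ = inj₁ refl
∨-elim {false} b≡true = inj₂ b≡true

_==_ : Fin n → Fin n → Bool
x == y = does (x ≟ y)

==-refl : (x : Fin n) → x == x ≡ true
==-refl x with x ≟ x
... | yes _ = refl
... | no x≢x = ⊥-elim (x≢x refl)

==⇒≡ : {x y : Fin n} → x == y ≡ true → x ≡ y
==⇒≡ {x = x} {y} x==y with x ≟ y
... | yes x≡y = x≡y

≢⇒==false : {x y : Fin n} → x ≢ y → x == y ≡ false
≢⇒==false {x = x} {y} x≢y with x ≟ y
... | yes x≡y = ⊥-elim (x≢y x≡y)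
... | no _ = refl

suc-==-suc : (x y : Fin n) → suc x == suc y ≡ x == y
suc-==-suc x y with x ≟ y
... | yes refl = refl
... | no _ = refl

-- Counting

bit : Bool → ℕ
bit true = 1
bit false = 0

bit-mono : (a ≡ true → b ≡ true) → bit a ≤ bit b
bit-mono {false} _ = z≤n
bit-mono {true} a⇒b rewrite a⇒b refl = ≤-refl

count : (Fin n → Bool) → ℕ
count {zero} P = 0
count {suc n} P = bit (P zero) + count (P ∘ suc)

count-cong : (∀ x → P x ≡ Q x) → count P ≡ count Q
count-cong {zero} _ = refl
count-cong {suc n} P≡Q = cong₂ _+_ (cong bit (P≡Q zero)) (count-cong (P≡Q ∘ suc))

count≤n : (P : Fin n → Bool) → count P ≤ n
count≤n {zero} _ = z≤n
count≤n {suc n} P = +-mono-≤ (bit≤1 (P zero)) (count≤n (P ∘ suc))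
  where
  bit≤1 : ∀ b → bit b ≤ 1
  bit≤1 true = ≤-refl
  bit≤1 false = z≤n

count-all : count {n} (λ _ → true) ≡ n
count-all {zero} = refl
count-all {suc n} = cong suc count-all

count-pos : (x : Fin n) → P x ≡ true → 0 < count P
count-pos {P = P} zero Px rewrite Px = s≤s z≤n
count-pos {P = P} (suc x) Px = ≤-trans (count-pos x Px) (m≤n+m _ (bit (P zero)))

count-mono : (∀ x → P x ≡ true → Q x ≡ true) → count P ≤ count Q
count-mono {zero} _ = z≤n
count-mono {suc n} P⊆Q = +-mono-≤ (bit-mono (P⊆Q zero)) (count-mono (P⊆Q ∘ suc))

count-mono-< : (∀ x → P x ≡ true → Q x ≡ true) → (x : Fin n) → P x ≡ false → Q x ≡ true → count P < count Q
count-mono-< {suc n} {P} {Q} P⊆Q zero Px Qx rewrite Px | Qx = s≤s (count-mono (P⊆Q ∘ suc))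
count-mono-< {suc n} {P} {Q} P⊆Q (suc x) Px Qx =
  +-mono-≤-< (bit-mono (P⊆Q zero)) (count-mono-< (P⊆Q ∘ suc) x Px Qx)

count-<⇒∃ : count P < count Q → ∃[ x ] (P x ≡ false × Q x ≡ true)
count-<⇒∃ {P = P} {Q} P<Q with any? (λ x → (P x ≟ᵇ false) ×-dec (Q x ≟ᵇ true))
... | yes witness = witness
... | no none = ⊥-elim (<⇒≱ P<Q (count-mono Q⊆P))
  where
  Q⊆P : ∀ x → Q x ≡ true → P x ≡ true
  Q⊆P x Qx with P x ≟ᵇ true
  ... | yes Px = Px
  ... | no ¬Px = ⊥-elim (none (x , ≢true⇒≡false ¬Px , Qx))

count-∨ : (∀ x → P x ∧ Q x ≡ false) → count (λ x → P x ∨ Q x) ≡ count P + count Q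
count-∨ {zero} _ = refl
count-∨ {suc n} {P} {Q} disjoint = begin
    bit (P zero ∨ Q zero) + count (λ x → P (suc x) ∨ Q (suc x))
  ≡⟨ cong₂ _+_ (bit-∨ (P zero) (Q zero) (disjoint zero)) (count-∨ (disjoint ∘ suc)) ⟩
    (bit (P zero) + bit (Q zero)) + (count (P ∘ suc) + count (Q ∘ suc))
  ≡⟨ interchange (bit (P zero)) (bit (Q zero)) (count (P ∘ suc)) (count (Q ∘ suc)) ⟩
    (bit (P zero) + count (P ∘ suc)) + (bit (Q zero) + count (Q ∘ suc))
  ∎
  where
  open ≡-Reasoning
  bit-∨ : ∀ a b → a ∧ b ≡ false → bit (a ∨ b) ≡ bit a + bit b
  bit-∨ true false _ = refl
  bit-∨ false _ _ = refl

count-remove : (y : Fin n) → Q y ≡ true → count Q ≡ suc (count (λ x → Q x ∧ not (x == y)))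
count-remove {suc n} {Q} zero Qy rewrite Qy | ==-refl {suc n} zero =
  cong suc (count-cong λ x → sym (∧-identityʳ (Q (suc x))))
count-remove {suc n} {Q} (suc y) Qy = begin
    bit (Q zero) + count (Q ∘ suc)
  ≡⟨ cong (bit (Q zero) +_) (count-remove y Qy) ⟩
    bit (Q zero) + suc (count (λ x → Q (suc x) ∧ not (x == y)))
  ≡⟨ +-suc _ _ ⟩
    suc (bit (Q zero) + count (λ x → Q (suc x) ∧ not (x == y)))
  ≡⟨ cong suc (cong₂ _+_ (cong bit (sym Q0∧true)) (count-cong λ x → cong (λ b → Q (suc x) ∧ not b) (sym (suc-==-suc x y)))) ⟩
    suc (bit (Q zero ∧ not (zero == suc y)) + count (λ x → Q (suc x) ∧ not (suc x == suc y))) ∎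
  where
  open ≡-Reasoning
  Q0∧true : Q zero ∧ not (zero == suc y) ≡ Q zero
  Q0∧true = trans (cong (λ b → Q zero ∧ not b) (≢⇒==false {x = zero} {suc y} λ ())) (∧-identityʳ _)

count-≤-injection : ∀ {m} {P : Fin n → Bool} {Q : Fin m → Bool} (φ : ∀ x → P x ≡ true → Fin m)
  → (∀ x Px → Q (φ x Px) ≡ true)
  → (∀ x y Px Py → φ x Px ≡ φ y Py → x ≡ y)
  → count P ≤ count Q
count-≤-injection {zero} _ _ _ = z≤n
count-≤-injection {suc n} {P = P} {Q} φ φ∈Q φ-inj with P zero in P0
... | false = count-≤-injection (φ ∘ suc) (φ∈Q ∘ suc) λ x y Px Py eq → suc-injective (φ-inj _ _ Px Py eq)
... | true = subst (suc (count (P ∘ suc)) ≤_) (sym (count-remove (φ zero P0) (φ∈Q zero P0)))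
    (s≤s (count-≤-injection (φ ∘ suc) φ∈Q' λ x y Px Py eq → suc-injective (φ-inj _ _ Px Py eq)))
  where
  φ∈Q' : ∀ x Px → Q (φ (suc x) Px) ∧ not (φ (suc x) Px == φ zero P0) ≡ true
  φ∈Q' x Px rewrite φ∈Q (suc x) Px | ≢⇒==false (λ eq → 0≢suc (φ-inj zero (suc x) P0 Px (sym eq))) = refl

rank : (Fin n → Bool) → Fin n → ℕ
rank P zero = 0
rank P (suc x) = bit (P zero) + rank (P ∘ suc) x

rank<count : (P : Fin n → Bool) (x : Fin n) → P x ≡ true → rank P x < count P
rank<count P zero Px rewrite Px = s≤s z≤n
rank<count P (suc x) Px = +-monoʳ-< (bit (P zero)) (rank<count (P ∘ suc) x Px)

rank-cong : {P Q : Fin n → Bool} → (∀ x → P x ≡ Q x) → ∀ y → rank P y ≡ rank Q y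
rank-cong P≡Q zero = refl
rank-cong P≡Q (suc y) = cong₂ _+_ (cong bit (P≡Q zero)) (rank-cong (P≡Q ∘ suc) y)

select : (P : Fin n → Bool) (k : ℕ) → k < count P → Fin n
select {suc n} P k k<count with P zero
select {suc n} P zero k<count | true = zero
select {suc n} P (suc k) k<count | true = suc (select (P ∘ suc) k (≤-pred k<count))
select {suc n} P k k<count | false = suc (select (P ∘ suc) k k<count)

select-∈ : (P : Fin n → Bool) (k : ℕ) (k<count : k < count P) → P (select P k k<count) ≡ true
select-∈ {suc n} P k k<count with P zero in P0
select-∈ {suc n} P zero k<count | true = P0
select-∈ {suc n} P (suc k) k<count | true = select-∈ (P ∘ suc) k (≤-pred k<count)
select-∈ {suc n} P k k<count | false = select-∈ (P ∘ suc) k k<count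

rank-select : (P : Fin n → Bool) (k : ℕ) (k<count : k < count P) → rank P (select P k k<count) ≡ k
rank-select {suc n} P k k<count with P zero in P0
rank-select {suc n} P zero k<count | true = refl
rank-select {suc n} P (suc k) k<count | true rewrite P0 = cong suc (rank-select (P ∘ suc) k (≤-pred k<count))
rank-select {suc n} P k k<count | false rewrite P0 = rank-select (P ∘ suc) k k<count

select-rank : (P : Fin n → Bool) (x : Fin n) → P x ≡ true → (lt : rank P x < count P) → select P (rank P x) lt ≡ x
select-rank {suc n} P zero Px lt with P zero
... | true = refl
select-rank {suc n} P (suc x) Px lt with P zero
... | true = cong suc (select-rank (P ∘ suc) x Px (≤-pred lt))
... | false = cong suc (select-rank (P ∘ suc) x Px lt)

select-cong : (P : Fin n → Bool) {k l : ℕ} (k<count : k < count P) (l<count : l < count P)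
  → k ≡ l → select P k k<count ≡ select P l l<count
select-cong P k<count l<count refl = cong (select P _) (<-irrelevant k<count l<count)

select-ext : {P Q : Fin n → Bool} → (∀ x → P x ≡ Q x) → (k : ℕ) (k<P : k < count P) (k<Q : k < count Q)
  → select P k k<P ≡ select Q k k<Q
select-ext {P = P} {Q} P≡Q k k<P k<Q = sym (begin
    select Q k k<Q
  ≡⟨ select-cong Q k<Q (rank<count Q x Qx) (sym rank-x) ⟩
    select Q (rank Q x) (rank<count Q x Qx)
  ≡⟨ select-rank Q x Qx _ ⟩
    x ∎)
  where
  open ≡-Reasoning
  x = select P k k<P
  Qx : Q x ≡ true
  Qx = trans (sym (P≡Q x)) (select-∈ P k k<P)
  rank-x : rank Q x ≡ k
  rank-x = trans (sym (rank-cong P≡Q x)) (rank-select P k k<P)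

countRange : (ℕ → Bool) → ℕ → ℕ → ℕ
countRange g o zero = 0
countRange g o (suc k) = bit (g o) + countRange g (suc o) k

countRange-+ : ∀ g o k l → countRange g o (k + l) ≡ countRange g o k + countRange g (k + o) l
countRange-+ g o zero l = refl
countRange-+ g o (suc k) l = trans
  (cong (bit (g o) +_) (trans (countRange-+ g (suc o) k l) (cong (λ p → countRange g (suc o) k + countRange g p l) (+-suc k o))))
  (sym (+-assoc (bit (g o)) _ _))

count-by-rank : (P : Fin n → Bool) (g : ℕ → Bool) (o : ℕ)
  → count (λ y → P y ∧ g (o + rank P y)) ≡ countRange g o (count P)
count-by-rank {zero} P g o = refl
count-by-rank {suc n} P g o with P zero
... | true = cong₂ _+_ (cong (bit ∘ g) (+-identityʳ o))
    (trans (count-cong λ y → cong (λ i → P (suc y) ∧ g i) (+-suc o _)) (count-by-rank (P ∘ suc) g (suc o)))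
... | false = count-by-rank (P ∘ suc) g o

<⇒<ᵇ≡true : ∀ {i m} → i < m → (i <ᵇ m) ≡ true
<⇒<ᵇ≡true {zero} (s≤s _) = refl
<⇒<ᵇ≡true {suc i} (s≤s i<m) = <⇒<ᵇ≡true i<m

≥⇒<ᵇ≡false : ∀ {i m} → m ≤ i → (i <ᵇ m) ≡ false
≥⇒<ᵇ≡false {i} z≤n = refl
≥⇒<ᵇ≡false (s≤s m≤i) = ≥⇒<ᵇ≡false m≤i

countRange-<ᵇ : ∀ m k → m ≤ k → countRange (_<ᵇ m) 0 k ≡ m
countRange-<ᵇ m k m≤k = begin
    countRange (_<ᵇ m) 0 k
  ≡⟨ cong (countRange (_<ᵇ m) 0) (sym (m+[n∸m]≡n m≤k)) ⟩
    countRange (_<ᵇ m) 0 (m + (k ∸ m))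
  ≡⟨ countRange-+ (_<ᵇ m) 0 m (k ∸ m) ⟩
    countRange (_<ᵇ m) 0 m + countRange (_<ᵇ m) (m + 0) (k ∸ m)
  ≡⟨ cong₂ _+_ (below 0 m ≤-refl) (above (m + 0) (k ∸ m) (m≤m+n m 0)) ⟩
    m + 0
  ≡⟨ +-identityʳ m ⟩
    m ∎
  where
  open ≡-Reasoning
  below : ∀ o l → o + l ≤ m → countRange (_<ᵇ m) o l ≡ l
  below o zero _ = refl
  below o (suc l) o+l<m rewrite <⇒<ᵇ≡true (≤-trans (s≤s (m≤m+n o l)) (subst (_≤ m) (+-suc o l) o+l<m)) =
    cong suc (below (suc o) l (subst (_≤ m) (+-suc o l) o+l<m))
  above : ∀ o l → m ≤ o → countRange (_<ᵇ m) o l ≡ 0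
  above o zero _ = refl
  above o (suc l) m≤o rewrite ≥⇒<ᵇ≡false m≤o = above (suc o) l (m≤n⇒m≤1+n m≤o)

count-rank<ᵇ : (P : Fin n → Bool) (m : ℕ) → m ≤ count P → count (λ y → P y ∧ (rank P y <ᵇ m)) ≡ m
count-rank<ᵇ P m m≤count = trans (count-by-rank P (_<ᵇ m) 0) (countRange-<ᵇ m (count P) m≤count)

suc4 : Fin 4 → Fin 4
suc4 zero = suc zero
suc4 (suc zero) = suc (suc zero)
suc4 (suc (suc zero)) = suc (suc (suc zero))
suc4 (suc (suc (suc zero))) = zero

mod4 : ℕ → Fin 4
mod4 zero = zero
mod4 (suc k) = suc4 (mod4 k)

mod4-+4 : ∀ o → mod4 (4 + o) ≡ mod4 o
mod4-+4 o = from-yes (all? λ x → suc4 (suc4 (suc4 (suc4 x))) ≟ x) (mod4 o)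

mod4-*4+ : ∀ q o → mod4 (q * 4 + o) ≡ mod4 o
mod4-*4+ zero o = refl
mod4-*4+ (suc q) o = trans (cong mod4 (+-assoc 4 (q * 4) o)) (trans (mod4-+4 (q * 4 + o)) (mod4-*4+ q o))

countRange-mod4 : ∀ j o q → countRange (λ i → mod4 i == j) o (q * 4) ≡ q
countRange-mod4 j o zero = refl
countRange-mod4 j o (suc q) = begin
    countRange hits o (4 + q * 4)
  ≡⟨ countRange-+ hits o 4 (q * 4) ⟩
    countRange hits o 4 + countRange hits (4 + o) (q * 4)
  ≡⟨ cong₂ _+_ (window (mod4 o) j) (trans (shift o (q * 4)) (countRange-mod4 j o q)) ⟩
    suc q ∎
  where
  open ≡-Reasoning
  hits : ℕ → Bool
  hits i = mod4 i == j
  -- every window of four consecutive residues meets j exactly once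
  window : ∀ x j → bit (x == j) + (bit (suc4 x == j) + (bit (suc4 (suc4 x) == j) + (bit (suc4 (suc4 (suc4 x)) == j) + 0))) ≡ 1
  window = from-yes (all? λ x → all? λ j →
    bit (x == j) + (bit (suc4 x == j) + (bit (suc4 (suc4 x) == j) + (bit (suc4 (suc4 (suc4 x)) == j) + 0))) ≟ℕ 1)
  shift : ∀ o k → countRange hits (4 + o) k ≡ countRange hits o k
  shift o zero = refl
  shift o (suc k) = cong₂ _+_ (cong (λ x → bit (x == j)) (mod4-+4 o)) (shift (suc o) k)

count-rank-mod4 : (P : Fin n → Bool) (o q : ℕ) (j : Fin 4) → count P ≡ q * 4
  → count (λ y → P y ∧ (mod4 (o + rank P y) == j)) ≡ q
count-rank-mod4 P o q j count≡ = trans (count-by-rank P (λ i → mod4 i == j) o)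
  (trans (cong (countRange _ o) count≡) (countRange-mod4 j o q))

-- Connectivity

any : ∀ {n} → (Fin n → Bool) → Bool
any {zero} P = false
any {suc n} P = P zero ∨ any (P ∘ suc)

any-sound : ∀ {n} (P : Fin n → Bool) → any P ≡ true → ∃[ x ] P x ≡ true
any-sound {suc n} P anyP with P zero in P0
... | true = zero , P0
... | false = let x , Px = any-sound (P ∘ suc) anyP in suc x , Px

any-complete : ∀ {n} (P : Fin n → Bool) (x : Fin n) → P x ≡ true → any P ≡ true
any-complete P zero Px rewrite Px = refl
any-complete P (suc x) Px = ∨-injʳ (any-complete (P ∘ suc) x Px)

module Connectivity {n : ℕ} (X : Graph n) where

  reachWithin : ℕ → Fin n → Fin n → Bool
  reachWithin zero u v = u == v
  reachWithin (suc k) u v = reachWithin k u v ∨ any (λ w → reachWithin k u w ∧ E X w v)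

  reachWithin-sound : ∀ k u v → reachWithin k u v ≡ true → Reach X u v
  reachWithin-sound zero u v u==v rewrite ==⇒≡ {x = u} {v} u==v = ε
  reachWithin-sound (suc k) u v w with ∨-elim {reachWithin k u v} w
  ... | inj₁ short = reachWithin-sound k u v short
  ... | inj₂ step = let w , uw∧wv = any-sound _ step in
    reachWithin-sound k u w (∧-projˡ uw∧wv) ◅◅ (∧-projʳ uw∧wv ◅ ε)

  reachWithin-refl : ∀ k u → reachWithin k u u ≡ true
  reachWithin-refl zero u = ==-refl u
  reachWithin-refl (suc k) u = ∨-injˡ (reachWithin-refl k u)

  Closed : ℕ → Fin n → Set
  Closed k u = ∀ w v → reachWithin k u w ≡ true → E X w v ≡ true → reachWithin k u v ≡ true

  closed⇒stable : ∀ {k u} → Closed k u → ∀ v → reachWithin (suc k) u v ≡ reachWithin k u v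
  closed⇒stable {k} {u} closed v = ⇔⇒≡ shrink ∨-injˡ
    where
    shrink : reachWithin (suc k) u v ≡ true → reachWithin k u v ≡ true
    shrink w with ∨-elim {reachWithin k u v} w
    ... | inj₁ short = short
    ... | inj₂ step = let w , uw∧wv = any-sound _ step in closed w v (∧-projˡ uw∧wv) (∧-projʳ uw∧wv)

  stable⇒closed : ∀ {k u} → (∀ v → reachWithin (suc k) u v ≡ reachWithin k u v) → Closed (suc k) u
  stable⇒closed {k} {u} stable w v uw wv =
    ∨-injʳ (any-complete (λ w → reachWithin k u w ∧ E X w v) w (∧-intro (trans (sym (stable w)) uw) wv))

  -- Until the search closes up, every round reaches a new vertex.
  grows-or-closed : ∀ u k → suc k ≤ count (reachWithin k u) ⊎ Closed k u
  grows-or-closed u zero = inj₁ (count-pos u (==-refl u))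
  grows-or-closed u (suc k) with grows-or-closed u k
  ... | inj₂ closed = inj₂ (stable⇒closed {k} {u} (closed⇒stable {k} {u} closed))
  ... | inj₁ big with any? (λ v → (reachWithin k u v ≟ᵇ false) ×-dec (reachWithin (suc k) u v ≟ᵇ true))
  ...   | yes (v , old , new) = inj₁ (≤-trans (s≤s big) (count-mono-< (λ _ → ∨-injˡ) v old new))
  ...   | no nothing-new = inj₂ (stable⇒closed {k} {u} stable)
    where
    stable : ∀ v → reachWithin (suc k) u v ≡ reachWithin k u v
    stable v = ⇔⇒≡ shrink ∨-injˡ
      where
      shrink : reachWithin (suc k) u v ≡ true → reachWithin k u v ≡ true
      shrink new with reachWithin k u v ≟ᵇ true
      ... | yes old = old
      ... | no ¬old = ⊥-elim (nothing-new (v , ≢true⇒≡false ¬old , new))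

  reach : Fin n → Fin n → Bool
  reach = reachWithin n

  reach-closed : ∀ u → Closed n u
  reach-closed u with grows-or-closed u n
  ... | inj₁ big = ⊥-elim (1+n≰n (≤-trans big (count≤n (reachWithin n u))))
  ... | inj₂ closed = closed

  reach-refl : ∀ u → reach u u ≡ true
  reach-refl = reachWithin-refl n

  reach-sound : ∀ u v → reach u v ≡ true → Reach X u v
  reach-sound = reachWithin-sound n

  reach-complete : ∀ u v → Reach X u v → reach u v ≡ true
  reach-complete u v walk = go walk (reach-refl u)
    where
    go : ∀ {a b} → Reach X a b → reach u a ≡ true → reach u b ≡ true
    go ε ua = ua
    go (ab ◅ walk) ua = go walk (reach-closed u _ _ ua ab)

  reach-sym : ∀ u v → reach u v ≡ true → reach v u ≡ true
  reach-sym u v uv = reach-complete v u (reverse (λ {a} {b} ab → trans (E-sym X b a) ab) (reach-sound u v uv))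

  reach-trans : ∀ u v w → reach u v ≡ true → reach v w ≡ true → reach u w ≡ true
  reach-trans u v w uv vw = reach-complete u w (reach-sound u v uv ◅◅ reach-sound v w vw)

  reach-edge : ∀ u v → E X u v ≡ true → reach u v ≡ true
  reach-edge u v uv = reach-complete u v (uv ◅ ε)

  reach-cong : ∀ u v → reach u v ≡ true → ∀ w → reach u w ≡ reach v w
  reach-cong u v uv w = ⇔⇒≡ (reach-trans v u w (reach-sym u v uv)) (reach-trans u v w uv)

  Reach-V : ∀ {u v} → Reach X u v → V X u ≡ true → V X v ≡ true
  Reach-V ε Vu = Vu
  Reach-V {u} (_◅_ {j = w} uw walk) Vu = Reach-V walk (E-V X w u (trans (E-sym X w u) uw))

  reach-V : ∀ u v → V X u ≡ true → reach u v ≡ true → V X v ≡ true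
  reach-V u v Vu uv = Reach-V (reach-sound u v uv) Vu

  Reach-closed : (C : Fin n → Bool) → (∀ u v → C u ≡ true → E X u v ≡ true → C v ≡ true)
    → ∀ {u v} → Reach X u v → C u ≡ true → C v ≡ true
  Reach-closed C closed ε Cu = Cu
  Reach-closed C closed (uw ◅ walk) Cu = Reach-closed C closed walk (closed _ _ Cu uw)

  reach-isComponent : ∀ x → V X x ≡ true → IsComponent X (reach x)
  reach-isComponent x Vx = (x , reach-refl x) , (λ v → reach-V x v Vx)
    , (λ u v xu xv → reach-sound u v (reach-trans u x v (reach-sym x u xu) xv))
    , (λ u v xu uv → reach-trans x u v xu (reach-edge u v uv))

  component-reach : ∀ C → IsComponent X C → ∀ x → C x ≡ true → ∀ v → C v ≡ reach x v
  component-reach C (_ , _ , connected , closed) x Cx v =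
    ⇔⇒≡ (λ Cv → reach-complete x v (connected x v Cx Cv)) (λ xv → Reach-closed C closed (reach-sound x v xv) Cx)

  repOf : Fin n → Fin n
  repOf v = select (reach v) 0 (count-pos v (reach-refl v))

  reach-repOf : ∀ v → reach v (repOf v) ≡ true
  reach-repOf v = select-∈ (reach v) 0 _

  repOf-cong : ∀ u v → reach u v ≡ true → repOf u ≡ repOf v
  repOf-cong u v uv = select-ext (reach-cong u v uv) 0 _ _

  IsRep : Fin n → Bool
  IsRep x = V X x ∧ (repOf x == x)

  IsRep⇒V : ∀ x → IsRep x ≡ true → V X x ≡ true
  IsRep⇒V x = ∧-projˡ

  IsRep⇒repOf : ∀ x → IsRep x ≡ true → repOf x ≡ x
  IsRep⇒repOf x r = ==⇒≡ (∧-projʳ {V X x} r)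

  IsRep-repOf : ∀ v → V X v ≡ true → IsRep (repOf v) ≡ true
  IsRep-repOf v Vv = ∧-intro (reach-V v (repOf v) Vv (reach-repOf v))
    (trans (cong (_== repOf v) (sym (repOf-cong v (repOf v) (reach-repOf v)))) (==-refl (repOf v)))

  IsRep-unique : ∀ x y → IsRep x ≡ true → IsRep y ≡ true → reach x y ≡ true → x ≡ y
  IsRep-unique x y rx ry xy = trans (sym (IsRep⇒repOf x rx)) (trans (repOf-cong x y xy) (IsRep⇒repOf y ry))

-- Isomorphism

≗⇒≅ : {G G' : Graph n} → (∀ u → V G u ≡ V G' u) → (∀ u v → E G u v ≡ E G' u v) → G ≅ G'
≗⇒≅ V≡ E≡ = record
  { f = λ u → u ; g = λ u → u
  ; f-V = λ u Vu → trans (sym (V≡ u)) Vu ; g-V = λ u Vu → trans (V≡ u) Vu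
  ; gf = λ _ _ → refl ; fg = λ _ _ → refl
  ; f-E = λ u v _ _ → E≡ u v }

≅-sym : {G : Graph n} {H : Graph m} → G ≅ H → H ≅ G
≅-sym {H = H} G≅H = record
  { f = g ; g = f ; f-V = g-V ; g-V = f-V ; gf = fg ; fg = gf
  ; f-E = λ w w' Vw Vw' → sym (trans (f-E (g w) (g w') (g-V w Vw) (g-V w' Vw')) (cong₂ (E H) (fg w Vw) (fg w' Vw'))) }
  where open _≅_ G≅H

≅-trans : {G : Graph n} {H : Graph m} {K : Graph k} → G ≅ H → H ≅ K → G ≅ K
≅-trans G≅H H≅K = record
  { f = λ u → J.f (I.f u) ; g = λ w → I.g (J.g w)
  ; f-V = λ u Vu → J.f-V _ (I.f-V u Vu) ; g-V = λ w Vw → I.g-V _ (J.g-V w Vw)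
  ; gf = λ u Vu → trans (cong I.g (J.gf _ (I.f-V u Vu))) (I.gf u Vu)
  ; fg = λ w Vw → trans (cong J.f (I.fg _ (J.g-V w Vw))) (J.fg w Vw)
  ; f-E = λ u v Vu Vv → trans (I.f-E u v Vu Vv) (J.f-E _ _ (I.f-V u Vu) (I.f-V v Vv)) }
  where
  module I = _≅_ G≅H
  module J = _≅_ H≅K

private
  cons : ∀ {a b} → Fin b → (Fin a → Fin b) → Fin (suc a) → Fin b
  cons x h zero = x
  cons x h (suc i) = h i

∃-map? : ∀ {a b} (P : (Fin a → Fin b) → Set) → (∀ f → Dec (P f))
  → (∀ f f' → (∀ i → f i ≡ f' i) → P f → P f') → Dec (∃ P)
∃-map? {zero} P P? resp with P? (λ ())
... | yes Pf = yes (_ , Pf)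
... | no ¬Pf = no λ (f , Pf) → ¬Pf (resp f _ (λ ()) Pf)
∃-map? {suc a} P P? resp with any? (λ x → ∃-map? (λ h → P (cons x h)) (λ h → P? (cons x h))
                                          (λ h h' h≗h' → resp (cons x h) (cons x h') λ { zero → refl ; (suc i) → h≗h' i }))
... | yes (x , h , Pf) = yes (_ , Pf)
... | no ¬P = no λ (f , Pf) → ¬P (f zero , (λ i → f (suc i)) , resp f _ (λ { zero → refl ; (suc i) → refl }) Pf)

module _ (G : Graph n) (H : Graph m) where

  private
    IsIso : (Fin n → Fin m) → (Fin m → Fin n) → Set
    IsIso f g = (∀ u → V G u ≡ true → V H (f u) ≡ true)
              × (∀ w → V H w ≡ true → V G (g w) ≡ true)
              × (∀ u → V G u ≡ true → g (f u) ≡ u)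
              × (∀ w → V H w ≡ true → f (g w) ≡ w)
              × (∀ u v → V G u ≡ true → V G v ≡ true → E G u v ≡ E H (f u) (f v))

    IsIso? : ∀ f g → Dec (IsIso f g)
    IsIso? f g = all? (λ u → (V G u ≟ᵇ true) →-dec (V H (f u) ≟ᵇ true))
           ×-dec all? (λ w → (V H w ≟ᵇ true) →-dec (V G (g w) ≟ᵇ true))
           ×-dec all? (λ u → (V G u ≟ᵇ true) →-dec (g (f u) ≟ u))
           ×-dec all? (λ w → (V H w ≟ᵇ true) →-dec (f (g w) ≟ w))
           ×-dec all? (λ u → all? λ v → (V G u ≟ᵇ true) →-dec ((V G v ≟ᵇ true) →-dec (E G u v ≟ᵇ E H (f u) (f v))))

    IsIso-respˡ : ∀ g f f' → (∀ i → f i ≡ f' i) → IsIso f g → IsIso f' g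
    IsIso-respˡ g f f' f≗f' (f-V , g-V , gf , fg , f-E) =
        (λ u Vu → subst (λ w → V H w ≡ true) (f≗f' u) (f-V u Vu)) , g-V
      , (λ u Vu → trans (cong g (sym (f≗f' u))) (gf u Vu))
      , (λ w Vw → trans (sym (f≗f' (g w))) (fg w Vw))
      , (λ u v Vu Vv → trans (f-E u v Vu Vv) (cong₂ (E H) (f≗f' u) (f≗f' v)))

    IsIso-respʳ : ∀ f g g' → (∀ i → g i ≡ g' i) → IsIso f g → IsIso f g'
    IsIso-respʳ f g g' g≗g' (f-V , g-V , gf , fg , f-E) =
        f-V , (λ w Vw → subst (λ u → V G u ≡ true) (g≗g' w) (g-V w Vw))
      , (λ u Vu → trans (sym (g≗g' (f u))) (gf u Vu))
      , (λ w Vw → trans (cong f (sym (g≗g' w))) (fg w Vw)) , f-E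

  -- abstract, so that type checking never unfolds the exhaustive search
  abstract
    _≅?_ : Dec (G ≅ H)
    _≅?_ with ∃-map? (λ f → ∃ (IsIso f)) (λ f → ∃-map? (IsIso f) (IsIso? f) (IsIso-respʳ f))
                     (λ f f' f≗f' (g , iso) → g , IsIso-respˡ g f f' f≗f' iso)
    ... | yes (f , g , f-V , g-V , gf , fg , f-E) =
      yes record { f = f ; g = g ; f-V = f-V ; g-V = g-V ; gf = gf ; fg = fg ; f-E = f-E }
    ... | no ¬iso = no λ G≅H → let open _≅_ G≅H in ¬iso (f , g , f-V , g-V , gf , fg , f-E)

≅-refl : {G : Graph n} → G ≅ G
≅-refl = ≗⇒≅ (λ _ → refl) (λ _ _ → refl)

≅?-sound : (G : Graph n) (H : Graph m) → does (G ≅? H) ≡ true → G ≅ H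
≅?-sound G H iso with G ≅? H
... | yes G≅H = G≅H

≅?-complete : (G : Graph n) (H : Graph m) → G ≅ H → does (G ≅? H) ≡ true
≅?-complete G H = dec-true (G ≅? H)

≅?-cong : {G : Graph n} {G' : Graph m} {H : Graph k} {H' : Graph l} → G ≅ G' → H ≅ H'
  → does (G ≅? H) ≡ does (G' ≅? H')
≅?-cong {G = G} {G'} {H} {H'} G≅G' H≅H' = ⇔⇒≡
  (λ GH → ≅?-complete G' H' (≅-trans (≅-sym G≅G') (≅-trans (≅?-sound G H GH) H≅H')))
  (λ GH' → ≅?-complete G H (≅-trans G≅G' (≅-trans (≅?-sound G' H' GH') (≅-sym H≅H'))))

-- Stars and their edge counts

sumᶠ : (Fin n → ℕ) → ℕ
sumᶠ {zero} h = 0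
sumᶠ {suc n} h = h zero + sumᶠ (h ∘ suc)

sum-map-allFin : (h : Fin n → ℕ) → sum (map h (allFin n)) ≡ sumᶠ h
sum-map-allFin {n} h = trans (cong sum (map-tabulate id h)) (sum-tabulate h)
  where
  sum-tabulate : ∀ {n} (h : Fin n → ℕ) → sum (tabulate h) ≡ sumᶠ h
  sum-tabulate {zero} h = refl
  sum-tabulate {suc n} h = cong (h zero +_) (sum-tabulate (h ∘ suc))

sumᶠ-cong : {h k : Fin n → ℕ} → (∀ x → h x ≡ k x) → sumᶠ h ≡ sumᶠ k
sumᶠ-cong {zero} _ = refl
sumᶠ-cong {suc n} h≡k = cong₂ _+_ (h≡k zero) (sumᶠ-cong (h≡k ∘ suc))

sumᶠ-+ : (h k : Fin n → ℕ) → sumᶠ (λ x → h x + k x) ≡ sumᶠ h + sumᶠ k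
sumᶠ-+ {zero} h k = refl
sumᶠ-+ {suc n} h k = trans (cong (h zero + k zero +_) (sumᶠ-+ (h ∘ suc) (k ∘ suc)))
  (interchange (h zero) (k zero) (sumᶠ (h ∘ suc)) (sumᶠ (k ∘ suc)))

sumᶠ-bit : (P : Fin n → Bool) → sumᶠ (bit ∘ P) ≡ count P
sumᶠ-bit {zero} P = refl
sumᶠ-bit {suc n} P = cong (bit (P zero) +_) (sumᶠ-bit (P ∘ suc))

sumᶠ-zero : (h : Fin n → ℕ) → (∀ x → h x ≡ 0) → sumᶠ h ≡ 0
sumᶠ-zero {zero} h _ = refl
sumᶠ-zero {suc n} h h≡0 rewrite h≡0 zero = sumᶠ-zero (h ∘ suc) (h≡0 ∘ suc)

sumᶠ-point : (h : Fin n → ℕ) (z : Fin n) → (∀ x → x == z ≡ false → h x ≡ 0) → sumᶠ h ≡ h z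
sumᶠ-point {suc n} h zero off =
  trans (cong (h zero +_) (sumᶠ-zero (h ∘ suc) λ x → off (suc x) refl)) (+-identityʳ (h zero))
sumᶠ-point {suc n} h (suc z) off = trans (cong (_+ sumᶠ (h ∘ suc)) (off zero refl))
  (sumᶠ-point (h ∘ suc) z λ x x≠z → off (suc x) (trans (suc-==-suc x z) x≠z))

_≺_ : Fin n → Fin n → Bool
i ≺ j = toℕ i <ᵇ toℕ j

≺-connex : (i j : Fin n) → i ≢ j → bit (i ≺ j) + bit (j ≺ i) ≡ 1
≺-connex i j i≢j with <-cmp (toℕ i) (toℕ j)
... | tri< i<j _ _ rewrite <⇒<ᵇ≡true i<j | ≥⇒<ᵇ≡false (<⇒≤ i<j) = refl
... | tri≈ _ i≡j _ = ⊥-elim (i≢j (toℕ-injective i≡j))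
... | tri> _ _ j<i rewrite <⇒<ᵇ≡true j<i | ≥⇒<ᵇ≡false (<⇒≤ j<i) = refl

e-as-sumᶠ : (G : Graph n) → e G ≡ sumᶠ (λ i → sumᶠ (λ j → bit (i ≺ j ∧ E G i j)))
e-as-sumᶠ {n} G = trans (sum-map-allFin {n} _) (sumᶠ-cong λ i → trans (sum-map-allFin {n} _) (sumᶠ-cong λ j → if-bit (i ≺ j ∧ E G i j)))
  where
  if-bit : ∀ b → (if b then 1 else 0) ≡ bit b
  if-bit true = refl
  if-bit false = refl

e-cong : (G G' : Graph n) → (∀ u v → E G u v ≡ E G' u v) → e G ≡ e G'
e-cong G G' E≡ = trans (e-as-sumᶠ G) (trans (sumᶠ-cong λ i → sumᶠ-cong λ j → cong (λ b → bit (i ≺ j ∧ b)) (E≡ i j))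
  (sym (e-as-sumᶠ G')))

starE : Fin n → (Fin n → Bool) → Fin n → Fin n → Bool
starE z L u v = ((u == z) ∧ L v) ∨ ((v == z) ∧ L u)

star : (centre : Fin n) (leaves : Fin n → Bool) → leaves centre ≡ false → Graph n
star z L Lz = record
  { V = λ u → (u == z) ∨ L u
  ; E = starE z L
  ; E-sym = λ u v → ∨-comm ((u == z) ∧ L v) ((v == z) ∧ L u)
  ; E-irr = irreflexive
  ; E-V = endpoint
  }
  where
  endpoint : ∀ u v → starE z L u v ≡ true → (u == z) ∨ L u ≡ true
  endpoint u v uv with ∨-elim {(u == z) ∧ L v} uv
  ... | inj₁ from-u = ∨-injˡ (∧-projˡ {u == z} from-u)
  ... | inj₂ to-u = ∨-injʳ (∧-projʳ {v == z} to-u)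
  irreflexive : ∀ u → starE z L u u ≡ false
  irreflexive u with u ≟ z
  ... | yes refl rewrite Lz = refl
  ... | no _ = refl

module _ (z : Fin n) (L : Fin n → Bool) (Lz : L z ≡ false) where

  e-star : e (star z L Lz) ≡ count L
  e-star = begin
      e (star z L Lz)
    ≡⟨ e-as-sumᶠ (star z L Lz) ⟩
      sumᶠ (λ i → sumᶠ (λ j → bit (i ≺ j ∧ starE z L i j)))
    ≡⟨ sumᶠ-cong (λ i → trans (sumᶠ-cong (split i)) (sumᶠ-+ {n} _ _)) ⟩
      sumᶠ (λ i → sumᶠ (λ j → bit (i ≺ j ∧ ((i == z) ∧ L j))) + sumᶠ (λ j → bit (i ≺ j ∧ ((j == z) ∧ L i))))
    ≡⟨ sumᶠ-+ {n} _ _ ⟩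
      sumᶠ (λ i → sumᶠ (λ j → bit (i ≺ j ∧ ((i == z) ∧ L j)))) + sumᶠ (λ i → sumᶠ (λ j → bit (i ≺ j ∧ ((j == z) ∧ L i))))
    ≡⟨ cong₂ _+_ from-centre (sumᶠ-cong to-centre) ⟩
      sumᶠ (λ j → bit (z ≺ j ∧ L j)) + sumᶠ (λ j → bit (j ≺ z ∧ L j))
    ≡⟨ sym (sumᶠ-+ {n} _ _) ⟩
      sumᶠ (λ j → bit (z ≺ j ∧ L j) + bit (j ≺ z ∧ L j))
    ≡⟨ sumᶠ-cong one-orientation ⟩
      sumᶠ (bit ∘ L)
    ≡⟨ sumᶠ-bit L ⟩
      count L ∎
    where
    open ≡-Reasoning
    split : ∀ i j → bit (i ≺ j ∧ starE z L i j) ≡ bit (i ≺ j ∧ ((i == z) ∧ L j)) + bit (i ≺ j ∧ ((j == z) ∧ L i))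
    split i j = bit-∧-∨ (i ≺ j) _ _ (disjoint i j)
      where
      bit-∧-∨ : ∀ a b c → b ∧ c ≡ false → bit (a ∧ (b ∨ c)) ≡ bit (a ∧ b) + bit (a ∧ c)
      bit-∧-∨ false b c _ = refl
      bit-∧-∨ true true false _ = refl
      bit-∧-∨ true false c _ = refl
      disjoint : ∀ i j → ((i == z) ∧ L j) ∧ ((j == z) ∧ L i) ≡ false
      disjoint i j with i ≟ z | j ≟ z
      ... | no _ | _ = refl
      ... | yes refl | yes refl rewrite Lz = refl
      ... | yes refl | no _ = ∧-zeroʳ (L j)
    from-centre : sumᶠ (λ i → sumᶠ (λ j → bit (i ≺ j ∧ ((i == z) ∧ L j)))) ≡ sumᶠ (λ j → bit (z ≺ j ∧ L j))
    from-centre = trans (sumᶠ-point _ z off) (cong (λ b → sumᶠ (λ j → bit (z ≺ j ∧ (b ∧ L j)))) (==-refl z))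
      where
      off : ∀ i → i == z ≡ false → sumᶠ (λ j → bit (i ≺ j ∧ ((i == z) ∧ L j))) ≡ 0
      off i i≠z rewrite i≠z = sumᶠ-zero _ λ j → cong bit (∧-zeroʳ (i ≺ j))
    to-centre : ∀ i → sumᶠ (λ j → bit (i ≺ j ∧ ((j == z) ∧ L i))) ≡ bit (i ≺ z ∧ L i)
    to-centre i = trans (sumᶠ-point _ z off) (cong (λ b → bit (i ≺ z ∧ (b ∧ L i))) (==-refl z))
      where
      off : ∀ j → j == z ≡ false → bit (i ≺ j ∧ ((j == z) ∧ L i)) ≡ 0
      off j j≠z rewrite j≠z = cong bit (∧-zeroʳ (i ≺ j))
    one-orientation : ∀ j → bit (z ≺ j ∧ L j) + bit (j ≺ z ∧ L j) ≡ bit (L j)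
    one-orientation j with j ≟ z
    ... | yes refl rewrite Lz | ∧-zeroʳ (j ≺ j) = refl
    ... | no j≢z with L j
    ...   | false rewrite ∧-zeroʳ (z ≺ j) | ∧-zeroʳ (j ≺ z) = refl
    ...   | true rewrite ∧-identityʳ (z ≺ j) | ∧-identityʳ (j ≺ z) = ≺-connex z j (λ z≡j → j≢z (sym z≡j))

xor≡∧not∨∧not : ∀ a b → xor a b ≡ (a ∧ not b) ∨ (b ∧ not a)
xor≡∧not∨∧not true true = refl
xor≡∧not∨∧not true false = refl
xor≡∧not∨∧not false true = refl
xor≡∧not∨∧not false false = refl

module _ (z : Fin n) (L : Fin n → Bool) (Lz : L z ≡ false) where

  private
    -- The leaves, in increasing order, become 1, …, count L; the centre (and every non-vertex) becomes 0.
    index : ∀ u b → L u ≡ b → Fin (suc (count L))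
    index u true Lu = suc (fromℕ< (rank<count L u Lu))
    index u false _ = zero

    toK1 : Fin n → Fin (suc (count L))
    toK1 u = index u (L u) refl

    toK1-leaf : ∀ u (Lu : L u ≡ true) → toK1 u ≡ suc (fromℕ< (rank<count L u Lu))
    toK1-leaf u Lu = leaf (L u) refl Lu
      where
      leaf : ∀ b (eq : L u ≡ b) → b ≡ true → index u b eq ≡ suc (fromℕ< (rank<count L u Lu))
      leaf true _ _ = refl

    toK1-nonleaf : ∀ u → L u ≡ false → toK1 u ≡ zero
    toK1-nonleaf u ¬Lu = nonleaf (L u) refl ¬Lu
      where
      nonleaf : ∀ b (eq : L u ≡ b) → b ≡ false → index u b eq ≡ zero
      nonleaf false _ _ = refl

    isZero-toK1 : ∀ u → isZero (toK1 u) ≡ not (L u)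
    isZero-toK1 u = isZero-index (L u) refl
      where
      isZero-index : ∀ b (eq : L u ≡ b) → isZero (index u b eq) ≡ not b
      isZero-index true _ = refl
      isZero-index false _ = refl

    fromK1 : Fin (suc (count L)) → Fin n
    fromK1 zero = z
    fromK1 (suc k) = select L (toℕ k) (toℕ<n k)

    leaf-fromK1 : ∀ k → L (fromK1 (suc k)) ≡ true
    leaf-fromK1 k = select-∈ L (toℕ k) (toℕ<n k)

    L≡not-centre : ∀ u → (u == z) ∨ L u ≡ true → L u ≡ not (u == z)
    L≡not-centre u Vu with u ≟ z
    ... | yes refl = Lz
    ... | no _ = Vu

    fromK1-toK1 : ∀ u → (u == z) ∨ L u ≡ true → fromK1 (toK1 u) ≡ u
    fromK1-toK1 u Vu with u ≟ z
    ... | yes refl = cong fromK1 (toK1-nonleaf u Lz)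
    ... | no _ = begin
        fromK1 (toK1 u)
      ≡⟨ cong fromK1 (toK1-leaf u Vu) ⟩
        select L (toℕ (fromℕ< (rank<count L u Vu))) _
      ≡⟨ select-cong L _ (rank<count L u Vu) (toℕ-fromℕ< (rank<count L u Vu)) ⟩
        select L (rank L u) (rank<count L u Vu)
      ≡⟨ select-rank L u Vu _ ⟩
        u ∎
      where open ≡-Reasoning

    toK1-fromK1 : ∀ k → toK1 (fromK1 k) ≡ k
    toK1-fromK1 zero = toK1-nonleaf z Lz
    toK1-fromK1 (suc k) = trans (toK1-leaf _ (leaf-fromK1 k))
      (cong suc (toℕ-injective (trans (toℕ-fromℕ< _) (rank-select L (toℕ k) (toℕ<n k)))))

    edges : ∀ u v → (u == z) ∨ L u ≡ true → (v == z) ∨ L v ≡ true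
      → starE z L u v ≡ xor (isZero (toK1 u)) (isZero (toK1 v))
    edges u v Vu Vv rewrite isZero-toK1 u | isZero-toK1 v | L≡not-centre u Vu | L≡not-centre v Vv
      with u == z | v == z
    ... | true | true = refl
    ... | true | false = refl
    ... | false | true = refl
    ... | false | false = refl

  star≅K1 : star z L Lz ≅ K1 (count L)
  star≅K1 = record
    { f = toK1 ; g = fromK1
    ; f-V = λ _ _ → refl
    ; g-V = λ { zero _ → ∨-injˡ (==-refl z) ; (suc k) _ → ∨-injʳ (leaf-fromK1 k) }
    ; gf = fromK1-toK1
    ; fg = λ k _ → toK1-fromK1 k
    ; f-E = edges
    }

-- Counting components by isomorphism type

lookup-tabulate-∃ : ∀ {A : Set} {k} (f : Fin k → A) (i : Fin (length (tabulate f)))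
  → ∃[ j ] (lookup (tabulate f) i ≡ f j × toℕ j ≡ toℕ i)
lookup-tabulate-∃ {k = suc k} f zero = zero , refl , refl
lookup-tabulate-∃ {k = suc k} f (suc i) = let j , eq , j≡i = lookup-tabulate-∃ (λ x → f (suc x)) i in suc j , eq , cong suc j≡i

compGraph-cong : (X : Graph n) {C D : Fin n → Bool} (c : IsComponent X C) (d : IsComponent X D)
  → (∀ v → C v ≡ D v) → compGraph X C c ≅ compGraph X D d
compGraph-cong X c d C≡D = ≗⇒≅ C≡D (λ u v → cong (λ b → b ∧ E X u v) (cong₂ _∧_ (C≡D u) (C≡D v)))

IsComponent-cong : (X : Graph n) {C D : Fin n → Bool} → (∀ v → C v ≡ D v) → IsComponent X C → IsComponent X D
IsComponent-cong X C≡D ((x , Cx) , C⊆V , connected , closed) =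
    (x , trans (sym (C≡D x)) Cx) , (λ u Du → C⊆V u (trans (C≡D u) Du))
  , (λ u v Du Dv → connected u v (trans (C≡D u) Du) (trans (C≡D v) Dv))
  , (λ u v Du uv → trans (sym (C≡D v)) (closed u v (trans (C≡D u) Du) uv))

record ComponentSystem (X : Graph n) : Set where
  field
    isRep : Fin n → Bool
    comp : Fin n → Fin n → Bool
    comp-isComponent : ∀ x → isRep x ≡ true → IsComponent X (comp x)
    comp-self : ∀ x → isRep x ≡ true → comp x x ≡ true
    comp-complete : ∀ C → IsComponent X C → ∃[ x ] (isRep x ≡ true × (∀ v → C v ≡ comp x v))
    comp-injective : ∀ x y → isRep x ≡ true → isRep y ≡ true → comp x y ≡ true → x ≡ y

  compGraphOf : ∀ x → isRep x ≡ true → Graph n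
  compGraphOf x r = compGraph X (comp x) (comp-isComponent x r)

module ComponentCount {X : Graph n} (S : ComponentSystem X) {m} (F : Graph m) (K : Fin n → Bool)
  (K⇒≅ : ∀ x r → K x ≡ true → ComponentSystem.compGraphOf S x r ≅ F)
  (≅⇒K : ∀ x r → ComponentSystem.compGraphOf S x r ≅ F → K x ≡ true) where

  open ComponentSystem S

  Marked : Fin n → Bool
  Marked x = isRep x ∧ K x

  private
    Marked-comp : ∀ C (c : IsComponent X C) → compGraph X C c ≅ F
      → ∀ x → isRep x ≡ true → (∀ v → C v ≡ comp x v) → Marked x ≡ true
    Marked-comp C c C≅F x r C≡ = ∧-intro r (≅⇒K x r (≅-trans (compGraph-cong X (comp-isComponent x r) c (λ v → sym (C≡ v))) C≅F))

  compCount⇒≡ : ∀ k → CompCount X F k → k ≡ count Marked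
  compCount⇒≡ k (Cs , length≡k , listed≅F , distinct , complete) =
    trans (sym length≡k) (trans (sym count-all) (≤-antisym (count-≤-injection repOfListed repOfListed-Marked repOfListed-injective)
                                                            (count-≤-injection indexOf (λ _ _ → refl) indexOf-injective)))
    where
    repOfListed : (i : Fin (length Cs)) → true ≡ true → Fin n
    repOfListed i _ = proj₁ (comp-complete _ (proj₂ (lookup Cs i)))
    repOfListed-Marked : ∀ i p → Marked (repOfListed i p) ≡ true
    repOfListed-Marked i _ = let x , r , C≡ = comp-complete _ (proj₂ (lookup Cs i)) in
      Marked-comp _ (proj₂ (lookup Cs i)) (listed≅F i) x r C≡
    repOfListed-injective : ∀ i j p q → repOfListed i p ≡ repOfListed j q → i ≡ j
    repOfListed-injective i j p q eq with i ≟ j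
    ... | yes i≡j = i≡j
    ... | no i≢j = let v , differ = distinct i j i≢j
                       _ , _ , Ci≡ = comp-complete _ (proj₂ (lookup Cs i))
                       _ , _ , Cj≡ = comp-complete _ (proj₂ (lookup Cs j))
                   in ⊥-elim (differ (trans (Ci≡ v) (trans (cong (λ x → comp x v) eq) (sym (Cj≡ v)))))
    indexOf : (x : Fin n) → Marked x ≡ true → Fin (length Cs)
    indexOf x Mx = proj₁ (complete (comp x) (comp-isComponent x r) (K⇒≅ x r (∧-projʳ {isRep x} Mx)))
      where r = ∧-projˡ Mx
    indexOf-injective : ∀ x y Mx My → indexOf x Mx ≡ indexOf y My → x ≡ y
    indexOf-injective x y Mx My eq = comp-injective x y rx ry (begin
        comp x y
      ≡⟨ proj₂ (complete (comp x) (comp-isComponent x rx) (K⇒≅ x rx (∧-projʳ {isRep x} Mx))) y ⟩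
        proj₁ (lookup Cs (indexOf x Mx)) y
      ≡⟨ cong (λ i → proj₁ (lookup Cs i) y) eq ⟩
        proj₁ (lookup Cs (indexOf y My)) y
      ≡⟨ sym (proj₂ (complete (comp y) (comp-isComponent y ry) (K⇒≅ y ry (∧-projʳ {isRep y} My))) y) ⟩
        comp y y
      ≡⟨ comp-self y ry ⟩
        true ∎)
      where
      open ≡-Reasoning
      rx = ∧-projˡ Mx
      ry = ∧-projˡ My

  private
    listedRep : Fin (count Marked) → Fin n
    listedRep j = select Marked (toℕ j) (toℕ<n j)

    listedRep-Marked : ∀ j → Marked (listedRep j) ≡ true
    listedRep-Marked j = select-∈ Marked (toℕ j) (toℕ<n j)

    listedRep-isRep : ∀ j → isRep (listedRep j) ≡ true
    listedRep-isRep j = ∧-projˡ (listedRep-Marked j)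

    listedRep-injective : ∀ j j' → listedRep j ≡ listedRep j' → j ≡ j'
    listedRep-injective j j' eq = toℕ-injective (trans (sym (rank-select Marked (toℕ j) (toℕ<n j)))
      (trans (cong (rank Marked) eq) (rank-select Marked (toℕ j') (toℕ<n j'))))

    entry : Fin (count Marked) → Σ (Fin n → Bool) (IsComponent X)
    entry j = comp (listedRep j) , comp-isComponent (listedRep j) (listedRep-isRep j)

    listed≅F : ∀ i → compGraph X (proj₁ (lookup (tabulate entry) i)) (proj₂ (lookup (tabulate entry) i)) ≅ F
    listed≅F i with lookup-tabulate-∃ entry i
    ... | j , eq , _ rewrite eq = K⇒≅ (listedRep j) (listedRep-isRep j) (∧-projʳ {isRep (listedRep j)} (listedRep-Marked j))

    listed-distinct : ∀ i i' → i ≢ i' → ∃[ v ] proj₁ (lookup (tabulate entry) i) v ≢ proj₁ (lookup (tabulate entry) i') v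
    listed-distinct i i' i≢i' with lookup-tabulate-∃ entry i | lookup-tabulate-∃ entry i'
    ... | j , eq , j≡i | j' , eq' , j'≡i' rewrite eq | eq' = listedRep j , λ same →
      i≢i' (toℕ-injective (trans (sym j≡i) (trans (cong toℕ (listedRep-injective j j' (sym (comp-injective _ _
        (listedRep-isRep j') (listedRep-isRep j) (trans (sym same) (comp-self (listedRep j) (listedRep-isRep j))))))) j'≡i')))

    listed-complete : ∀ C (c : IsComponent X C) → compGraph X C c ≅ F
      → ∃[ i ] (∀ v → C v ≡ proj₁ (lookup (tabulate entry) i) v)
    listed-complete C c C≅F = i , λ v → trans (C≡ v) (trans (cong (λ y → comp y v) (sym listed-x)) (sym (cong (λ e → proj₁ e v) eq)))
      where
      x = proj₁ (comp-complete C c)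
      r = proj₁ (proj₂ (comp-complete C c))
      C≡ = proj₂ (proj₂ (comp-complete C c))
      Mx : Marked x ≡ true
      Mx = Marked-comp C c C≅F x r C≡
      rank<length : rank Marked x < length (tabulate entry)
      rank<length = subst (rank Marked x <_) (sym (length-tabulate entry)) (rank<count Marked x Mx)
      i = fromℕ< rank<length
      j = proj₁ (lookup-tabulate-∃ entry i)
      eq = proj₁ (proj₂ (lookup-tabulate-∃ entry i))
      listed-x : listedRep j ≡ x
      listed-x = trans (select-cong Marked (toℕ<n j) (rank<count Marked x Mx)
                          (trans (proj₂ (proj₂ (lookup-tabulate-∃ entry i))) (toℕ-fromℕ< rank<length)))
                       (select-rank Marked x Mx _)

  compCount : CompCount X F (count Marked)
  compCount = tabulate entry , length-tabulate entry , listed≅F , listed-distinct , listed-complete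

-- Splitting H into four quarters

∧-reorder : ∀ r k {v p p'} → (r ≡ true → v ≡ true) → (r ≡ true → k ≡ true → p ≡ p')
  → (r ∧ (v ∧ p)) ∧ k ≡ (r ∧ k) ∧ p'
∧-reorder false k _ _ = refl
∧-reorder true false {v} {p} _ _ = ∧-zeroʳ (v ∧ p)
∧-reorder true true v≡ p≡ rewrite v≡ refl | p≡ refl refl = ∧-identityʳ _

module FourWaySplit {n : ℕ} (H : Graph n) where
  open Connectivity H public

  component : Fin n → Fin n → Bool
  component x v = V H x ∧ reach x v

  component⇒V : ∀ x v → component x v ≡ true → V H v ≡ true
  component⇒V x v xv = reach-V x v (∧-projˡ xv) (∧-projʳ {V H x} xv)

  component≡reach : ∀ x → V H x ≡ true → ∀ v → component x v ≡ reach x v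
  component≡reach x Vx v rewrite Vx = refl

  componentGraph : Fin n → Graph n
  componentGraph x = induced H (component x) (component⇒V x)

  component-complete : ∀ C → IsComponent H C → ∃[ x ] (IsRep x ≡ true × (∀ v → C v ≡ component x v))
  component-complete C c@((x , Cx) , C⊆V , _) = repOf x , IsRep-repOf x Vx , λ v → begin
      C v                  ≡⟨ component-reach C c x Cx v ⟩
      reach x v            ≡⟨ reach-cong x (repOf x) (reach-repOf x) v ⟩
      reach (repOf x) v    ≡⟨ sym (component≡reach (repOf x) (reach-V x _ Vx (reach-repOf x)) v) ⟩
      component (repOf x) v ∎
    where
    open ≡-Reasoning
    Vx = C⊆V x Cx

  componentSystem : ComponentSystem H
  componentSystem = record
    { isRep = IsRep
    ; comp = component
    ; comp-isComponent = λ x r → IsComponent-cong H (λ v → sym (component≡reach x (IsRep⇒V x r) v))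
                                                  (reach-isComponent x (IsRep⇒V x r))
    ; comp-self = λ x r → ∧-intro (IsRep⇒V x r) (reach-refl x)
    ; comp-complete = component-complete
    ; comp-injective = λ x y rx ry xy → IsRep-unique x y rx ry (∧-projʳ {V H x} xy)
    }

  _~_ : Fin n → Fin n → Bool
  x ~ y = does (componentGraph x ≅? componentGraph y)

  rankInType : Fin n → ℕ
  rankInType y = rank (λ z → IsRep z ∧ (y ~ z)) y

  part : ℕ → Fin n → Fin 4
  part shift v = mod4 (shift + rankInType (repOf v))

  module ComponentsIsomorphicTo {m} (F : Graph m) where

    OfType : Fin n → Bool
    OfType z = does (F ≅? componentGraph z)

    Marked : Fin n → Bool
    Marked z = IsRep z ∧ OfType z

    rankInType≡rank : ∀ y → OfType y ≡ true → rankInType y ≡ rank Marked y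
    rankInType≡rank y Fy = rank-cong (λ z → cong (IsRep z ∧_) (≅?-cong (≅-sym (≅?-sound F _ Fy)) ≅-refl)) y

    module Count = ComponentCount componentSystem F OfType
      (λ x r Fx → ≅-trans (≗⇒≅ (λ _ → refl) (λ _ _ → refl)) (≅-sym (≅?-sound F _ Fx)))
      (λ x r x≅F → ≅?-complete F _ (≅-trans (≅-sym x≅F) (≗⇒≅ (λ _ → refl) (λ _ _ → refl))))

  module Parts (shift : ℕ) where

    InPart : Fin 4 → Fin n → Bool
    InPart j v = V H v ∧ (part shift v == j)

    Hpart : Fin 4 → Graph n
    Hpart j = induced H (InPart j) (λ v → ∧-projˡ)

    InPart-reach : ∀ j u v → reach u v ≡ true → V H u ≡ true → InPart j u ≡ InPart j v
    InPart-reach j u v uv Vu rewrite Vu | reach-V u v Vu uv | repOf-cong u v uv = refl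

    InPart-edge : ∀ j u v → InPart j u ≡ true → E H u v ≡ true → InPart j v ≡ true
    InPart-edge j u v Ju uv = trans (sym (InPart-reach j u v (reach-edge u v uv) (∧-projˡ Ju))) Ju

    InPart-component : ∀ j x → InPart j x ≡ true → ∀ v → component x v ≡ true → InPart j v ≡ true
    InPart-component j x Jx v xv = trans (sym (InPart-reach j x v (∧-projʳ {V H x} xv) (∧-projˡ Jx))) Jx

    Reach-lift : ∀ j {a b} → Reach H a b → InPart j a ≡ true → Reach (Hpart j) a b
    Reach-lift j ε _ = ε
    Reach-lift j {a} (_◅_ {j = b} ab walk) Ja =
      ∧-intro (∧-intro Ja (InPart-edge j a b Ja ab)) ab ◅ Reach-lift j walk (InPart-edge j a b Ja ab)

    Reach-lower : ∀ j {a b} → Reach (Hpart j) a b → Reach H a b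
    Reach-lower j ε = ε
    Reach-lower j (_◅_ {i = a} {j = b} ab walk) = ∧-projʳ {InPart j a ∧ InPart j b} ab ◅ Reach-lower j walk

    partSystem : ∀ j → ComponentSystem (Hpart j)
    partSystem j = record
      { isRep = λ x → IsRep x ∧ InPart j x
      ; comp = component
      ; comp-isComponent = isComponent
      ; comp-self = λ x r → ∧-intro (IsRep⇒V x (∧-projˡ r)) (reach-refl x)
      ; comp-complete = complete
      ; comp-injective = λ x y rx ry xy → IsRep-unique x y (∧-projˡ rx) (∧-projˡ ry) (∧-projʳ {V H x} xy)
      }
      where
      isComponent : ∀ x → IsRep x ∧ InPart j x ≡ true → IsComponent (Hpart j) (component x)
      isComponent x r = (x , ∧-intro Vx (reach-refl x)) , InPart-component j x Jx
        , (λ u v xu xv → Reach-lift j (reach-sound u v (reach-trans u x v (reach-sym x u (∧-projʳ {V H x} xu))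
                                                                              (∧-projʳ {V H x} xv)))
                                      (InPart-component j x Jx u xu))
        , (λ u v xu uv → ∧-intro Vx (reach-trans x u v (∧-projʳ {V H x} xu)
                                       (reach-edge u v (∧-projʳ {InPart j u ∧ InPart j v} uv))))
        where
        Vx = IsRep⇒V x (∧-projˡ r)
        Jx = ∧-projʳ {IsRep x} r
      complete : ∀ C → IsComponent (Hpart j) C → ∃[ x ] (IsRep x ∧ InPart j x ≡ true × (∀ v → C v ≡ component x v))
      complete C ((x , Cx) , C⊆J , connected , closed) = y , ∧-intro ry Jy , C≡
        where
        Jx = C⊆J x Cx
        Vx = ∧-projˡ Jx
        y = repOf x
        ry = IsRep-repOf x Vx
        Jy = trans (sym (InPart-reach j x y (reach-repOf x) Vx)) Jx
        C≡ : ∀ v → C v ≡ component y v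
        C≡ v = ⇔⇒≡
          (λ Cv → ∧-intro (IsRep⇒V y ry)
                    (reach-trans y x v (reach-sym x y (reach-repOf x))
                                       (reach-complete x v (Reach-lower j (connected x v Cx Cv)))))
          (λ yv → Connectivity.Reach-closed (Hpart j) C closed
                    (Reach-lift j (reach-sound x v (reach-trans x y v (reach-repOf x) (∧-projʳ {V H y} yv))) Jx) Cx)

    partComponent≅ : ∀ j x r → ComponentSystem.compGraphOf (partSystem j) x r ≅ componentGraph x
    partComponent≅ j x r = ≗⇒≅ (λ _ → refl) same-edges
      where
      same-edges : ∀ u v → (component x u ∧ component x v) ∧ ((InPart j u ∧ InPart j v) ∧ E H u v)
                         ≡ (component x u ∧ component x v) ∧ E H u v
      same-edges u v with component x u in xu | component x v in xv
      ... | true | true rewrite InPart-component j x (∧-projʳ {IsRep x} r) u xu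
                              | InPart-component j x (∧-projʳ {IsRep x} r) v xv = refl
      ... | true | false = refl
      ... | false | _ = refl

    module ComponentsIsomorphicToInPart {m} (F : Graph m) (j : Fin 4) where
      open ComponentsIsomorphicTo F

      MarkedInPart : Fin n → Bool
      MarkedInPart z = (IsRep z ∧ InPart j z) ∧ OfType z

      MarkedInPart≡ : ∀ z → MarkedInPart z ≡ Marked z ∧ (mod4 (shift + rank Marked z) == j)
      MarkedInPart≡ z = ∧-reorder (IsRep z) (OfType z) (IsRep⇒V z) λ rz Fz →
        cong (λ r → mod4 (shift + r) == j) (trans (cong rankInType (IsRep⇒repOf z rz)) (rankInType≡rank z Fz))

      count-MarkedInPart : ∀ q → count Marked ≡ q * 4 → count MarkedInPart ≡ q
      count-MarkedInPart q Marked≡ = trans (count-cong MarkedInPart≡) (count-rank-mod4 Marked shift q j Marked≡)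

      module CountInPart = ComponentCount (partSystem j) F OfType
        (λ x r Fx → ≅-trans (partComponent≅ j x r) (≅-sym (≅?-sound F _ Fx)))
        (λ x r x≅F → ≅?-complete F _ (≅-trans (≅-sym x≅F) (partComponent≅ j x r)))

    Hpart-quarter : Divisible 4 H → ∀ j → IsQuarterOf (Hpart j) H
    Hpart-quarter div j F k cc with div F k cc
    ... | divides q k≡q*4 = subst (CompCount (Hpart j) F) count≡k/4 CountInPart.compCount
      where
      open ComponentsIsomorphicTo F
      open ComponentsIsomorphicToInPart F j
      count≡k/4 : count MarkedInPart ≡ k / 4
      count≡k/4 = trans (count-MarkedInPart q (trans (sym (Count.compCount⇒≡ k cc)) k≡q*4))
                        (sym (trans (cong (_/ 4) k≡q*4) (m*n/n≡m q 4)))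

    -- No part contains the whole component type of c, since that type has 4q ≥ 4 members, q per part.
    outside-part : Divisible 4 H → ∀ t c → V H c ≡ true → ∃[ w ] (V H w ≡ true × InPart t w ≡ false)
    outside-part div t c Vc = from-divisible (div F (count Marked) Count.compCount)
      where
      F = componentGraph (repOf c)
      open ComponentsIsomorphicTo F
      open ComponentsIsomorphicToInPart F t
      Marked-c : Marked (repOf c) ≡ true
      Marked-c = ∧-intro (IsRep-repOf c Vc) (≅?-complete F _ ≅-refl)
      fewer-in-part : ∀ q → count Marked ≡ suc q * 4 → count MarkedInPart < count Marked
      fewer-in-part q Marked≡ = subst₂ _<_ (sym (count-MarkedInPart (suc q) Marked≡)) (sym Marked≡)
                                          (m<m*n (suc q) 4 (s≤s (s≤s z≤n)))
      from-divisible : 4 ∣ count Marked → ∃[ w ] (V H w ≡ true × InPart t w ≡ false)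
      from-divisible (divides zero Marked≡) = ⊥-elim (<-irrefl (sym Marked≡) (count-pos (repOf c) Marked-c))
      from-divisible (divides (suc q) Marked≡) =
        let x , ¬Mx-in-t , Mx = count-<⇒∃ (fewer-in-part q Marked≡) in
        x , IsRep⇒V x (∧-projˡ Mx)
          , ≢true⇒≡false λ Jx → ≡true⇒≢false (∧-intro (∧-intro (∧-projˡ {IsRep x} Mx) Jx) (∧-projʳ {IsRep x} Mx)) ¬Mx-in-t

-- Splitting the star

pieces : ∀ {A : Set} → (Fin 4 → A) → (Fin 4 → A) → List A
pieces Hs Ss = Hs zero ∷ Hs (suc zero) ∷ Hs (suc (suc zero)) ∷ Hs (suc (suc (suc zero)))
             ∷ Ss zero ∷ Ss (suc zero) ∷ Ss (suc (suc zero)) ∷ Ss (suc (suc (suc zero))) ∷ []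

lookup-pieces : ∀ {A : Set} (Hs Ss : Fin 4 → A) i → lookup (pieces Hs Ss) i ≡ [ Hs , Ss ]′ (splitAt 4 i)
lookup-pieces Hs Ss zero = refl
lookup-pieces Hs Ss (suc zero) = refl
lookup-pieces Hs Ss (suc (suc zero)) = refl
lookup-pieces Hs Ss (suc (suc (suc zero))) = refl
lookup-pieces Hs Ss (suc (suc (suc (suc zero)))) = refl
lookup-pieces Hs Ss (suc (suc (suc (suc (suc zero))))) = refl
lookup-pieces Hs Ss (suc (suc (suc (suc (suc (suc zero)))))) = refl
lookup-pieces Hs Ss (suc (suc (suc (suc (suc (suc (suc zero))))))) = refl

-- Edge-disjointness follows once every edge of a piece is owned by that piece.
decomposition-by-owner : (G : Graph n) (Hs Ss : Fin 4 → Graph n) (owner : Fin n → Fin n → Fin 4 ⊎ Fin 4)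
  → (∀ k → [ Hs , Ss ]′ k ⊆G G)
  → (∀ k u v → E ([ Hs , Ss ]′ k) u v ≡ true → owner u v ≡ k)
  → (∀ u v → E G u v ≡ true → ∃[ k ] E ([ Hs , Ss ]′ k) u v ≡ true)
  → Decomposition G (pieces Hs Ss)
decomposition-by-owner G Hs Ss owner sub owned cover =
    (λ i → subst (_⊆G G) (sym (lookup-pieces Hs Ss i)) (sub (splitAt 4 i)))
  , (λ i j i≢j u v Ei → ≢true⇒≡false λ Ej → i≢j (begin
        i                             ≡⟨ join-splitAt 4 4 i ⟨
        join 4 4 (splitAt 4 i)        ≡⟨ cong (join 4 4) (trans (sym (owns i Ei)) (owns j Ej)) ⟩
        join 4 4 (splitAt 4 j)        ≡⟨ join-splitAt 4 4 j ⟩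
        j                             ∎))
  , λ u v uv → let k , Ek = cover u v uv in
      join 4 4 k , subst (λ X → E X u v ≡ true)
                     (sym (trans (lookup-pieces Hs Ss (join 4 4 k)) (cong [ Hs , Ss ]′ (splitAt-join 4 4 k)))) Ek
  where
  open ≡-Reasoning
  owns : ∀ i {u v} → E (lookup (pieces Hs Ss) i) u v ≡ true → owner u v ≡ splitAt 4 i
  owns i {u} {v} Ei = owned (splitAt 4 i) u v (subst (λ X → E X u v ≡ true) (lookup-pieces Hs Ss i) Ei)

module StarShape {n s : ℕ} {S : Graph n} (S≅K1 : S ≅ K1 s) where
  open _≅_ S≅K1

  centre : Fin n
  centre = g zero

  V-centre : V S centre ≡ true
  V-centre = g-V zero refl

  Leaf : Fin n → Bool
  Leaf u = V S u ∧ not (u == centre)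

  Leaf-centre : Leaf centre ≡ false
  Leaf-centre rewrite V-centre | ==-refl centre = refl

  Leaf⇒V : ∀ u → Leaf u ≡ true → V S u ≡ true
  Leaf⇒V u = ∧-projˡ

  Leaf⇒≢centre : ∀ u → Leaf u ≡ true → u ≢ centre
  Leaf⇒≢centre u Lu refl = ≡true⇒≢false Lu Leaf-centre

  isZero-f : ∀ u → V S u ≡ true → isZero (f u) ≡ (u == centre)
  isZero-f u Vu = ⇔⇒≡
    (λ fu≡0 → trans (cong (_== centre) (trans (sym (gf u Vu)) (cong g (isZero⇒zero fu≡0)))) (==-refl centre))
    (λ u==c → subst (λ x → isZero (f x) ≡ true) (sym (==⇒≡ u==c)) (cong isZero (fg zero refl)))
    where
    isZero⇒zero : ∀ {x : Fin (suc s)} → isZero x ≡ true → x ≡ zero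
    isZero⇒zero {zero} _ = refl

  private
    absent⇒isolated : ∀ u v → V S u ≢ true → E S u v ≡ starE centre Leaf u v
    absent⇒isolated u v ¬Vu = trans
      (≢true⇒≡false λ uv → ¬Vu (E-V S u v uv))
      (sym (≢true⇒≡false λ uv → ¬Vu (endpoint (E-V (star centre Leaf Leaf-centre) u v uv))))
      where
      endpoint : (u == centre) ∨ Leaf u ≡ true → V S u ≡ true
      endpoint c∨L with ∨-elim c∨L
      ... | inj₁ u==c = subst (λ x → V S x ≡ true) (sym (==⇒≡ u==c)) V-centre
      ... | inj₂ Lu = Leaf⇒V u Lu

  E≡starE : ∀ u v → E S u v ≡ starE centre Leaf u v
  E≡starE u v with V S u ≟ᵇ true | V S v ≟ᵇ true
  ... | yes Vu | yes Vv = begin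
      E S u v
    ≡⟨ f-E u v Vu Vv ⟩
      xor (isZero (f u)) (isZero (f v))
    ≡⟨ cong₂ xor (isZero-f u Vu) (isZero-f v Vv) ⟩
      xor (u == centre) (v == centre)
    ≡⟨ xor≡∧not∨∧not (u == centre) (v == centre) ⟩
      ((u == centre) ∧ not (v == centre)) ∨ ((v == centre) ∧ not (u == centre))
    ≡⟨ cong₂ (λ a b → ((u == centre) ∧ (a ∧ not (v == centre))) ∨ ((v == centre) ∧ (b ∧ not (u == centre))))
             (sym Vv) (sym Vu) ⟩
      starE centre Leaf u v ∎
    where open ≡-Reasoning
  ... | no ¬Vu | _ = absent⇒isolated u v ¬Vu
  ... | yes _ | no ¬Vv = trans (E-sym S u v) (trans (absent⇒isolated v u ¬Vv)
      (∨-comm ((v == centre) ∧ Leaf u) ((u == centre) ∧ Leaf v)))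

  e≡count-Leaf : e S ≡ count Leaf
  e≡count-Leaf = trans (e-cong S (star centre Leaf Leaf-centre) E≡starE) (e-star centre Leaf Leaf-centre)

SplitsIntoQuarters : (G H S : Graph n) → Set
SplitsIntoQuarters {n} G H S = Σ (Fin 4 → Graph n) λ Hs → Σ (Fin 4 → Graph n) λ Ss →
    Decomposition G (pieces Hs Ss)
  × (∀ (i : Fin 4) → VertexDisjoint (Hs i) (Ss i))
  × (∀ (i : Fin 4) → IsQuarterOf (Hs i) H)
  × (∀ (i : Fin 4) → IsStar (Ss i))
  × e (Ss zero) ≡ e S / 2

+≤+⇒≤⊎≤ : ∀ a b m → a + b ≤ m + m → a ≤ m ⊎ b ≤ m
+≤+⇒≤⊎≤ a b m a+b≤ with a ≤? m
... | yes a≤m = inj₁ a≤m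
... | no a≰m = inj₂ (<⇒≤ (+-cancelˡ-≤ m _ _ (≤-trans (≤-reflexive (+-suc m b)) (≤-trans (+-monoˡ-≤ b (≰⇒> a≰m)) a+b≤))))

m*2≡m+m : ∀ m → m * 2 ≡ m + m
m*2≡m+m m = trans (*-comm m 2) (cong (m +_) (+-identityʳ m))

FourDistinct : Fin 4 → Fin 4 → Set
FourDistinct c₀ o = c₀ ≢ zero × c₀ ≢ suc zero × o ≢ zero × o ≢ suc zero × o ≢ c₀

module Construction {s : ℕ} (G H S : Graph n) (S≅K1 : S ≅ K1 s) (dec : Decomposition G (H ∷ S ∷ []))
                    (div : Divisible 4 H) where
  open FourWaySplit H
  open StarShape S≅K1

  H⊆G : H ⊆G G
  H⊆G = proj₁ dec zero

  S⊆G : S ⊆G G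
  S⊆G = proj₁ dec (suc zero)

  centre-V : V G centre ≡ true
  centre-V = proj₁ S⊆G centre V-centre

  module Assignment (shift : ℕ) (c₀ o : Fin 4) (distinct : FourDistinct c₀ o) (part-centre : part shift centre ≡ c₀)
                    (m : ℕ) (Leaf≡ : count Leaf ≡ m * 2)
                    (few-in-0 : count (λ u → Leaf u ∧ Parts.InPart shift zero u) ≤ m) where
    open Parts shift

    c₀≢0 : c₀ ≢ zero
    c₀≢0 = proj₁ distinct

    c₀≢1 : c₀ ≢ suc zero
    c₀≢1 = proj₁ (proj₂ distinct)

    o≢0 : o ≢ zero
    o≢0 = proj₁ (proj₂ (proj₂ distinct))

    o≢1 : o ≢ suc zero
    o≢1 = proj₁ (proj₂ (proj₂ (proj₂ distinct)))

    o≢c₀ : o ≢ c₀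
    o≢c₀ = proj₂ (proj₂ (proj₂ (proj₂ distinct)))

    InPart-exclusive : ∀ a b v → InPart a v ≡ true → a ≢ b → InPart b v ≡ false
    InPart-exclusive a b v Jv a≢b = ≢true⇒≡false λ J'v →
      a≢b (trans (sym (==⇒≡ {x = part shift v} (∧-projʳ {V H v} Jv))) (==⇒≡ {x = part shift v} (∧-projʳ {V H v} J'v)))

    Spare : Fin n → Bool
    Spare u = Leaf u ∧ not (InPart zero u)

    Chosen : Fin n → Bool
    Chosen u = Spare u ∧ (rank Spare u <ᵇ m)

    -- The first m leaves outside part 0 go to star 0; the other leaves avoid their own part.
    colourOf : Bool → Bool → Fin 4
    colourOf true _ = zero
    colourOf false true = o
    colourOf false false = suc zero

    colour : Fin n → Fin 4
    colour u = colourOf (Chosen u) (InPart (suc zero) u)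

    colour≢c₀ : ∀ u → colour u ≢ c₀
    colour≢c₀ u = go (Chosen u) (InPart (suc zero) u)
      where
      go : ∀ a b → colourOf a b ≢ c₀
      go true _ eq = c₀≢0 (sym eq)
      go false true = o≢c₀
      go false false eq = c₀≢1 (sym eq)

    InPart-colour : ∀ u → InPart (colour u) u ≡ false
    InPart-colour u with Chosen u in chosen | InPart (suc zero) u in J1
    ... | true | _ = not≡true⇒≡false (∧-projʳ {Leaf u} (∧-projˡ chosen))
    ... | false | true = InPart-exclusive (suc zero) o u J1 (λ eq → o≢1 (sym eq))
    ... | false | false = J1

    spare-vertex : ∃[ w ] (V G w ≡ true × InPart c₀ w ≡ false)
    spare-vertex with V H centre ≟ᵇ true
    ... | yes Vc = let w , Vw , w∉c₀ = outside-part div c₀ centre Vc in w , proj₁ H⊆G w Vw , w∉c₀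
    ... | no ¬Vc = centre , centre-V , ≢true⇒≡false λ Jc → ¬Vc (∧-projˡ Jc)

    w : Fin n
    w = proj₁ spare-vertex

    hub : Fin 4 → Fin n
    hub i = if i == c₀ then w else centre

    hub-≢c₀ : ∀ i → i ≢ c₀ → hub i ≡ centre
    hub-≢c₀ i i≢c₀ rewrite ≢⇒==false i≢c₀ = refl

    StarLeaf : Fin 4 → Fin n → Bool
    StarLeaf i u = Leaf u ∧ (colour u == i)

    StarLeaf⇒≢c₀ : ∀ i u → StarLeaf i u ≡ true → i ≢ c₀
    StarLeaf⇒≢c₀ i u Lu refl = colour≢c₀ u (==⇒≡ (∧-projʳ {Leaf u} Lu))

    StarLeaf-hub : ∀ i → StarLeaf i (hub i) ≡ false
    StarLeaf-hub i with i ≟ c₀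
    ... | yes refl = ≢true⇒≡false λ Lw → StarLeaf⇒≢c₀ i _ Lw refl
    ... | no _ rewrite Leaf-centre = refl

    Spart : Fin 4 → Graph n
    Spart i = star (hub i) (StarLeaf i) (StarLeaf-hub i)

    Spart-edge : ∀ i u v → E (Spart i) u v ≡ true
      → (u ≡ centre × StarLeaf i v ≡ true) ⊎ (v ≡ centre × StarLeaf i u ≡ true)
    Spart-edge i u v uv with ∨-elim {(u == hub i) ∧ StarLeaf i v} uv
    ... | inj₁ out = inj₁ (trans (==⇒≡ (∧-projˡ out)) (hub-≢c₀ i (StarLeaf⇒≢c₀ i v Lv)) , Lv)
      where Lv = ∧-projʳ {u == hub i} out
    ... | inj₂ into = inj₂ (trans (==⇒≡ (∧-projˡ into)) (hub-≢c₀ i (StarLeaf⇒≢c₀ i u Lu)) , Lu)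
      where Lu = ∧-projʳ {v == hub i} into

    S-edge-out : ∀ v → Leaf v ≡ true → E S centre v ≡ true
    S-edge-out v Lv rewrite E≡starE centre v | ==-refl centre | Lv = refl

    S-edge-in : ∀ u → Leaf u ≡ true → E S u centre ≡ true
    S-edge-in u Lu = trans (E-sym S u centre) (S-edge-out u Lu)

    Spart-edge⇒S-edge : ∀ i u v → E (Spart i) u v ≡ true → E S u v ≡ true
    Spart-edge⇒S-edge i u v uv with Spart-edge i u v uv
    ... | inj₁ (refl , Lv) = S-edge-out v (∧-projˡ Lv)
    ... | inj₂ (refl , Lu) = S-edge-in u (∧-projˡ Lu)

    leafEnd : Fin n → Fin n → Fin n
    leafEnd u v = if u == centre then v else u

    owner : Fin n → Fin n → Fin 4 ⊎ Fin 4
    owner u v = if E S u v then inj₂ (colour (leafEnd u v)) else inj₁ (part shift u)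

    owned : ∀ k u v → E ([ Hpart , Spart ]′ k) u v ≡ true → owner u v ≡ k
    owned (inj₁ j) u v uv rewrite ≢true⇒≡false {E S u v} (λ S-uv → ≡true⇒≢false S-uv
                                    (proj₁ (proj₂ dec) zero (suc zero) (λ ()) u v (∧-projʳ {InPart j u ∧ InPart j v} uv))) =
      cong inj₁ (==⇒≡ (∧-projʳ {V H u} (∧-projˡ (∧-projˡ uv))))
    owned (inj₂ j) u v uv with Spart-edge j u v uv
    ... | inj₁ (refl , Lv) rewrite S-edge-out v (∧-projˡ Lv) | ==-refl centre =
      cong inj₂ (==⇒≡ (∧-projʳ {Leaf v} Lv))
    ... | inj₂ (refl , Lu) rewrite S-edge-in u (∧-projˡ Lu) | ≢⇒==false (Leaf⇒≢centre u (∧-projˡ Lu)) =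
      cong inj₂ (==⇒≡ (∧-projʳ {Leaf u} Lu))

    pieces⊆G : ∀ k → [ Hpart , Spart ]′ k ⊆G G
    pieces⊆G (inj₁ j) = (λ u Ju → proj₁ H⊆G u (∧-projˡ Ju))
                      , (λ u v uv → proj₂ H⊆G u v (∧-projʳ {InPart j u ∧ InPart j v} uv))
    pieces⊆G (inj₂ j) = V⊆ , (λ u v uv → proj₂ S⊆G u v (Spart-edge⇒S-edge j u v uv))
      where
      hub-V : V G (hub j) ≡ true
      hub-V with j == c₀
      ... | true = proj₁ (proj₂ spare-vertex)
      ... | false = centre-V
      V⊆ : ∀ u → (u == hub j) ∨ StarLeaf j u ≡ true → V G u ≡ true
      V⊆ u hub∨leaf with ∨-elim {u == hub j} hub∨leaf
      ... | inj₁ u==hub = subst (λ x → V G x ≡ true) (sym (==⇒≡ u==hub)) hub-V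
      ... | inj₂ Lu = proj₁ S⊆G u (Leaf⇒V u (∧-projˡ Lu))

    pieces-cover : ∀ u v → E G u v ≡ true → ∃[ k ] E ([ Hpart , Spart ]′ k) u v ≡ true
    pieces-cover u v uv with proj₂ (proj₂ dec) u v uv
    ... | zero , H-uv = inj₁ (part shift u) , ∧-intro (∧-intro Ju (InPart-edge _ u v Ju H-uv)) H-uv
      where Ju = ∧-intro (E-V H u v H-uv) (==-refl (part shift u))
    ... | suc zero , S-uv with ∨-elim {(u == centre) ∧ Leaf v} (trans (sym (E≡starE u v)) S-uv)
    ...   | inj₁ out = inj₂ (colour v) , ∨-injˡ (∧-intro u==hub (∧-intro (∧-projʳ {u == centre} out) (==-refl (colour v))))
      where u==hub = trans (cong (u ==_) (hub-≢c₀ (colour v) (colour≢c₀ v))) (∧-projˡ out)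
    ...   | inj₂ into = inj₂ (colour u) , ∨-injʳ (∧-intro v==hub (∧-intro (∧-projʳ {v == centre} into) (==-refl (colour u))))
      where v==hub = trans (cong (v ==_) (hub-≢c₀ (colour u) (colour≢c₀ u))) (∧-projˡ into)

    decomposition : Decomposition G (pieces Hpart Spart)
    decomposition = decomposition-by-owner G Hpart Spart owner pieces⊆G owned pieces-cover

    disjoint : ∀ j → VertexDisjoint (Hpart j) (Spart j)
    disjoint j u Ju = cong₂ _∨_ not-hub not-leaf
      where
      not-hub : u == hub j ≡ false
      not-hub with j ≟ c₀
      ... | yes refl = ≢⇒==false {x = u} {w} λ u≡w →
        ≡true⇒≢false (subst (λ x → InPart j x ≡ true) u≡w Ju) (proj₂ (proj₂ spare-vertex))
      ... | no j≢c₀ = ≢⇒==false {x = u} {centre} λ { refl →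
        j≢c₀ (trans (sym (==⇒≡ {x = part shift centre} (∧-projʳ {V H centre} Ju))) part-centre) }
      not-leaf : StarLeaf j u ≡ false
      not-leaf = ≢true⇒≡false λ Lu →
        ≡true⇒≢false Ju (subst (λ i → InPart i u ≡ false) (==⇒≡ (∧-projʳ {Leaf u} Lu)) (InPart-colour u))

    m≤count-Spare : m ≤ count Spare
    m≤count-Spare = +-cancelʳ-≤ (count InPart0) m (count Spare) (begin
        m + count InPart0                ≤⟨ +-monoʳ-≤ m few-in-0 ⟩
        m + m                            ≡⟨ m*2≡m+m m ⟨
        m * 2                            ≡⟨ Leaf≡ ⟨
        count Leaf                       ≡⟨ count-cong split ⟩
        count (λ u → Spare u ∨ InPart0 u) ≡⟨ count-∨ separate ⟩
        count Spare + count InPart0      ∎)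
      where
      open ≤-Reasoning
      InPart0 : Fin n → Bool
      InPart0 u = Leaf u ∧ InPart zero u
      split : ∀ u → Leaf u ≡ Spare u ∨ InPart0 u
      split u with Leaf u | InPart zero u
      ... | true | true = refl
      ... | true | false = refl
      ... | false | _ = refl
      separate : ∀ u → Spare u ∧ InPart0 u ≡ false
      separate u with Leaf u | InPart zero u
      ... | true | true = refl
      ... | true | false = refl
      ... | false | _ = refl

    count-StarLeaf-0 : count (StarLeaf zero) ≡ m
    count-StarLeaf-0 = trans (count-cong StarLeaf-0≡Chosen) (count-rank<ᵇ Spare m m≤count-Spare)
      where
      StarLeaf-0≡Chosen : ∀ u → StarLeaf zero u ≡ Chosen u
      StarLeaf-0≡Chosen u with Chosen u in chosen
      ... | true = cong (_∧ true) (∧-projˡ (∧-projˡ chosen))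
      ... | false with InPart (suc zero) u
      ...   | true = trans (cong (Leaf u ∧_) (≢⇒==false o≢0)) (∧-zeroʳ (Leaf u))
      ...   | false = ∧-zeroʳ (Leaf u)

    result : SplitsIntoQuarters G H S
    result = Hpart , Spart , decomposition , disjoint , Hpart-quarter div
           , (λ i → count (StarLeaf i) , star≅K1 (hub i) (StarLeaf i) (StarLeaf-hub i))
           , (begin
               e (Spart zero)        ≡⟨ e-star (hub zero) (StarLeaf zero) (StarLeaf-hub zero) ⟩
               count (StarLeaf zero) ≡⟨ count-StarLeaf-0 ⟩
               m                     ≡⟨ m*n/n≡m m 2 ⟨
               m * 2 / 2             ≡⟨ cong (_/ 2) (trans e≡count-Leaf Leaf≡) ⟨
               e S / 2               ∎)
      where open ≡-Reasoning

  r : ℕ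
  r = rankInType (repOf centre)

  shift₂ : ℕ
  shift₂ = r * 3 + 2

  part-centre₂ : part shift₂ centre ≡ suc (suc zero)
  part-centre₂ = trans (cong mod4 (solve 1 (λ r → r :* con 3 :+ con 2 :+ r := r :* con 4 :+ con 2) refl r)) (mod4-*4+ r 2)
    where open +-*-Solver

  part-centre₃ : part (suc shift₂) centre ≡ suc (suc (suc zero))
  part-centre₃ = cong suc4 part-centre₂

  LeafIn0 : ℕ → Fin n → Bool
  LeafIn0 shift u = Leaf u ∧ Parts.InPart shift zero u

  -- Raising the shift by one moves every vertex to the next part.
  LeafIn0-disjoint : ∀ u → LeafIn0 shift₂ u ∧ LeafIn0 (suc shift₂) u ≡ false
  LeafIn0-disjoint u = go (Leaf u) (V H u) (part shift₂ u)
    where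
    go : ∀ l v x → (l ∧ (v ∧ (x == zero))) ∧ (l ∧ (v ∧ (suc4 x == zero))) ≡ false
    go false _ _ = refl
    go true false _ = refl
    go true true zero = refl
    go true true (suc zero) = refl
    go true true (suc (suc zero)) = refl
    go true true (suc (suc (suc zero))) = refl

  split : 2 ∣ e S → SplitsIntoQuarters G H S
  split (divides m eS≡) =
    [ Assignment.result shift₂ (suc (suc zero)) (suc (suc (suc zero)))
        ((λ ()) , (λ ()) , (λ ()) , (λ ()) , (λ ())) part-centre₂ m Leaf≡
    , Assignment.result (suc shift₂) (suc (suc (suc zero))) (suc (suc zero))
        ((λ ()) , (λ ()) , (λ ()) , (λ ()) , (λ ())) part-centre₃ m Leaf≡
    ]′ (+≤+⇒≤⊎≤ (count (LeafIn0 shift₂)) (count (LeafIn0 (suc shift₂))) m both≤)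
    where
    open ≤-Reasoning
    Leaf≡ : count Leaf ≡ m * 2
    Leaf≡ = trans (sym e≡count-Leaf) eS≡
    both≤ : count (LeafIn0 shift₂) + count (LeafIn0 (suc shift₂)) ≤ m + m
    both≤ = begin
      count (LeafIn0 shift₂) + count (LeafIn0 (suc shift₂))  ≡⟨ count-∨ LeafIn0-disjoint ⟨
      count (λ u → LeafIn0 shift₂ u ∨ LeafIn0 (suc shift₂) u) ≤⟨ count-mono In0⇒Leaf ⟩
      count Leaf                                               ≡⟨ Leaf≡ ⟩
      m * 2                                                    ≡⟨ m*2≡m+m m ⟩
      m + m                                                    ∎
      where
      In0⇒Leaf : ∀ u → LeafIn0 shift₂ u ∨ LeafIn0 (suc shift₂) u ≡ true → Leaf u ≡ true
      In0⇒Leaf u in0 with ∨-elim {LeafIn0 shift₂ u} in0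
      ... | inj₁ in₂ = ∧-projˡ in₂
      ... | inj₂ in₃ = ∧-projˡ in₃

lemma3p5 : ∀ {n} (G H S : Graph n)
  → Divisible 4 H
  → IsStar S
  → 2 ∣ e S
  → Decomposition G (H ∷ S ∷ [])
  → Σ (Fin 4 → Graph n) λ Hs → Σ (Fin 4 → Graph n) λ Ss →
      ( Decomposition G (Hs zero ∷ Hs (suc zero) ∷ Hs (suc (suc zero)) ∷ Hs (suc (suc (suc zero)))
                       ∷ Ss zero ∷ Ss (suc zero) ∷ Ss (suc (suc zero)) ∷ Ss (suc (suc (suc zero))) ∷ [])
      × (∀ (i : Fin 4) → VertexDisjoint (Hs i) (Ss i))
      × (∀ (i : Fin 4) → IsQuarterOf (Hs i) H)
      × (∀ (i : Fin 4) → IsStar (Ss i))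
      × e (Ss zero) ≡ e S / 2 )
lemma3p5 G H S four-divisible (_ , S≅K1) even decomposition =
  Construction.split G H S S≅K1 decomposition four-divisible even
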